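{- Let $m,n\ge 1$ be integers with $\gcd(m,n)=1$, and let $g_4(m,n)$ be the number of $(a,b,c,d)\in\mathbb{Z}_n^4$ with $a+b+c+d\equiv m\pmod n$, $\gcd(abcd,n)=1$ and $\gcd(abc+abd+acd+bcd,n)=1$. Then \[ g_4(m,n)=\begin{cases} n^3\prod_{p\mid n}\left(1-\frac{5}{p}+\frac{12}{p^2}-\frac{13}{p^3}\right), &\text{if }n\text{ is odd},\\ 0, &\text{if }n\text{ is even}. \end{cases} \] -}

module Defs where

open import Data.Nat using (ℕ; zero; suc; _+_; _*_; NonZero)
open import Data.Nat.DivMod using (_%_)
open import Data.Nat.GCD using (gcd)
open import Data.Nat.Divisibility using (_∣_; _∣?_)
open import Data.Nat.Primality using (Prime; prime?)
open import Data.Fin using (Fin; toℕ)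
open import Data.List using (List; length; filter; allFin; upTo; foldr; concatMap; map)
open import Data.Product using (_×_; _,_)
open import Relation.Binary.PropositionalEquality using (_≡_)
open import Relation.Nullary.Decidable using (_×-dec_)
import Relation.Nullary.Decidable
import Data.Nat as ℕ
open import Data.Integer using (+_)
open import Data.Rational using (ℚ; _/_; 1ℚ) renaming (_+_ to _+ℚ_; _-_ to _-ℚ_; _*_ to _*ℚ_)

Quad : ℕ → Set
Quad n = Fin n × Fin n × Fin n × Fin n

allQuads : (n : ℕ) → List (Quad n)
allQuads n =
  concatMap (λ a → concatMap (λ b → concatMap (λ c → map (λ d → (a , b , c , d))
    (allFin n)) (allFin n)) (allFin n)) (allFin n)

Cond : (m n : ℕ) → .{{NonZero n}} → Quad n → Set
Cond m n (a , b , c , d) =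
  let x = toℕ a ; y = toℕ b ; z = toℕ c ; w = toℕ d in
  ((x + y + z + w) % n ≡ m % n)
  × (gcd (x * y * z * w) n ≡ 1)
  × (gcd (x * y * z + x * y * w + x * z * w + y * z * w) n ≡ 1)

cond? : (m n : ℕ) → .{{_ : NonZero n}} → (q : Quad n) → Relation.Nullary.Decidable.Dec (Cond m n q)
cond? m n (a , b , c , d) =
  let x = toℕ a ; y = toℕ b ; z = toℕ c ; w = toℕ d in
  ((x + y + z + w) % n ℕ.≟ m % n)
  ×-dec (gcd (x * y * z * w) n ℕ.≟ 1)
  ×-dec (gcd (x * y * z + x * y * w + x * z * w + y * z * w) n ℕ.≟ 1)

g4 : (m n : ℕ) → .{{NonZero n}} → ℕ
g4 m n = length (filter (cond? m n) (allQuads n))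

-- The primes p dividing n (n ≥ 1, so p ≤ n).
primeDivisors : ℕ → List ℕ
primeDivisors n = filter (λ p → prime? p ×-dec (p ∣? n)) (upTo (suc n))

-- The local factor 1 - 5/p + 12/p² - 13/p³  (p = 0 never occurs for primes).
localFactor : ℕ → ℚ
localFactor zero = 1ℚ
localFactor (suc k) =
  let x = (+ 1) / suc k in
  1ℚ -ℚ ((+ 5) / 1) *ℚ x +ℚ ((+ 12) / 1) *ℚ x *ℚ x -ℚ ((+ 13) / 1) *ℚ x *ℚ x *ℚ x

formula : ℕ → ℚ
formula n = ((+ (n * n * n)) / 1) *ℚ foldr _*ℚ_ 1ℚ (Data.List.map localFactor (primeDivisors n))

{-# OPTIONS --safe #-}
module Submission where

-- Eliminating d through a + b + c + d ≡ m, g₄(m, n) counts the triples (a, b, c) modulo n at which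
-- Q = abcd · e₃(a, b, c, d) is nonzero modulo every prime divisor of n. Writing residues modulo pN as
-- jN + r shows that this count is multiplicative: a prime p dividing N contributes a factor p³, and a new
-- prime p contributes the number of solutions modulo p. For an odd prime p ∤ m, scaling (b, c, d) by a
-- unit a (Q is homogeneous of degree 7) reduces that number to counting triples (x, y, z) with x, y, z,
-- 1 + x + y + z and xyz + xy + xz + yz all nonzero; inclusion–exclusion over conditions that are linear
-- in z evaluates it to (p - 3)³ + 4(p - 3)² + 9(p - 3) + 5 = p³ (1 - 5/p + 12/p² - 13/p³).
-- For even n, m is odd, and an odd a + b + c + d forces one of a, b, c, d to be even.

open import Data.Nat using (ℕ)
open import Data.Nat.Primality using (Prime)
open import Data.Integer using (ℤ)

module FiniteSums where

  open import Data.Nat using (ℕ; zero; suc; _+_; _*_; _<_; s≤s; z≤n)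
  open import Data.Nat.Properties
  open import Data.Nat.Tactic.RingSolver using (solve-∀)
  open import Data.Empty using (⊥-elim)
  open import Data.Product using (_×_; proj₁; proj₂)
  open import Relation.Binary.PropositionalEquality
  open import Relation.Nullary using (Dec; yes; no; ¬_)
  open import Relation.Nullary.Decidable using (_×-dec_; ¬?)

  ∑ : ℕ → (ℕ → ℕ) → ℕ
  ∑ zero    f = 0
  ∑ (suc n) f = f 0 + ∑ n (λ i → f (suc i))

  syntax ∑ n (λ i → e) = ∑[ i < n ] e

  ∑-cong-< : ∀ n {f g : ℕ → ℕ} → (∀ i → i < n → f i ≡ g i) → ∑ n f ≡ ∑ n g
  ∑-cong-< zero    eq = refl
  ∑-cong-< (suc n) eq = cong₂ _+_ (eq 0 (s≤s z≤n)) (∑-cong-< n (λ i i<n → eq (suc i) (s≤s i<n)))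

  ∑-cong : ∀ n {f g : ℕ → ℕ} → (∀ i → f i ≡ g i) → ∑ n f ≡ ∑ n g
  ∑-cong n eq = ∑-cong-< n (λ i _ → eq i)

  ∑-+ : ∀ n (f g : ℕ → ℕ) → ∑[ i < n ] (f i + g i) ≡ ∑ n f + ∑ n g
  ∑-+ zero    f g = refl
  ∑-+ (suc n) f g = begin
    f 0 + g 0 + ∑[ i < n ] (f (suc i) + g (suc i))      ≡⟨ cong (f 0 + g 0 +_) (∑-+ n _ _) ⟩
    f 0 + g 0 + (∑[ i < n ] f (suc i) + ∑[ i < n ] g (suc i))  ≡⟨ +-+-interchange (f 0) (g 0) _ _ ⟩
    f 0 + ∑[ i < n ] f (suc i) + (g 0 + ∑[ i < n ] g (suc i))  ∎
    where
      open ≡-Reasoning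
      +-+-interchange : ∀ a b c d → a + b + (c + d) ≡ a + c + (b + d)
      +-+-interchange = solve-∀

  ∑-*ˡ : ∀ n k (f : ℕ → ℕ) → ∑[ i < n ] (k * f i) ≡ k * ∑ n f
  ∑-*ˡ zero    k f = sym (*-zeroʳ k)
  ∑-*ˡ (suc n) k f = trans (cong (k * f 0 +_) (∑-*ˡ n k _)) (sym (*-distribˡ-+ k (f 0) _))

  ∑-*ʳ : ∀ n k (f : ℕ → ℕ) → ∑[ i < n ] (f i * k) ≡ ∑ n f * k
  ∑-*ʳ n k f = trans (∑-cong n (λ i → *-comm (f i) k)) (trans (∑-*ˡ n k f) (*-comm k _))

  ∑-const : ∀ n k → ∑[ _ < n ] k ≡ n * k
  ∑-const zero    k = refl
  ∑-const (suc n) k = cong (k +_) (∑-const n k)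

  ∑-0 : ∀ n → ∑[ _ < n ] 0 ≡ 0
  ∑-0 n = trans (∑-const n 0) (*-zeroʳ n)

  ∑-split : ∀ m n (f : ℕ → ℕ) → ∑ (m + n) f ≡ ∑ m f + ∑[ i < n ] f (m + i)
  ∑-split zero    n f = refl
  ∑-split (suc m) n f = trans (cong (f 0 +_) (∑-split m n (λ i → f (suc i)))) (sym (+-assoc (f 0) _ _))

  ∑-comm : ∀ m n (f : ℕ → ℕ → ℕ) → ∑[ i < m ] ∑[ j < n ] f i j ≡ ∑[ j < n ] ∑[ i < m ] f i j
  ∑-comm zero    n f = sym (∑-0 n)
  ∑-comm (suc m) n f = trans (cong (∑ n (f 0) +_) (∑-comm m n (λ i → f (suc i))))
                             (sym (∑-+ n (f 0) (λ j → ∑[ i < m ] f (suc i) j)))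

  ∑-blocks : ∀ m n (f : ℕ → ℕ) → ∑ (m * n) f ≡ ∑[ r < n ] ∑[ j < m ] f (j * n + r)
  ∑-blocks m n f = trans (block-by-block m f) (∑-comm m n (λ j r → f (j * n + r)))
    where
      block-by-block : ∀ m (f : ℕ → ℕ) → ∑ (m * n) f ≡ ∑[ j < m ] ∑[ r < n ] f (j * n + r)
      block-by-block zero    f = refl
      block-by-block (suc m) f = trans (∑-split n (m * n) f) (cong (∑ n f +_) (trans (block-by-block m (λ i → f (n + i)))
        (∑-cong m (λ j → ∑-cong n (λ r → cong f (sym (+-assoc n (j * n) r)))))))

  𝟙 : ∀ {a} {A : Set a} → Dec A → ℕ
  𝟙 (yes _) = 1
  𝟙 (no _)  = 0

  module _ {a} {A : Set a} where

    𝟙-yes : (A? : Dec A) → A → 𝟙 A? ≡ 1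
    𝟙-yes (yes _) _ = refl
    𝟙-yes (no ¬a) a = ⊥-elim (¬a a)

    𝟙-no : (A? : Dec A) → ¬ A → 𝟙 A? ≡ 0
    𝟙-no (yes a) ¬a = ⊥-elim (¬a a)
    𝟙-no (no _)  _  = refl

    𝟙-¬-+ : (A? : Dec A) → 𝟙 (¬? A?) + 𝟙 A? ≡ 1
    𝟙-¬-+ (yes _) = refl
    𝟙-¬-+ (no _)  = refl

    module _ {b} {B : Set b} where

      𝟙-⇔ : (A? : Dec A) (B? : Dec B) → (A → B) → (B → A) → 𝟙 A? ≡ 𝟙 B?
      𝟙-⇔ A? (yes b) _ B→A = 𝟙-yes A? (B→A b)
      𝟙-⇔ A? (no ¬b) A→B _ = 𝟙-no A? (λ a → ¬b (A→B a))

      𝟙-× : (A? : Dec A) (B? : Dec B) → 𝟙 (A? ×-dec B?) ≡ 𝟙 A? * 𝟙 B?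
      𝟙-× (yes _) (yes _) = refl
      𝟙-× (yes _) (no _)  = refl
      𝟙-× (no _)  _       = refl

  𝟙-inclusion-exclusion₂ : ∀ {a b} {A : Set a} {B : Set b} (A? : Dec A) (B? : Dec B) →
    𝟙 (¬? A?) * 𝟙 (¬? B?) + 𝟙 A? + 𝟙 B? ≡ 1 + 𝟙 A? * 𝟙 B?
  𝟙-inclusion-exclusion₂ (yes _) (yes _) = refl
  𝟙-inclusion-exclusion₂ (yes _) (no _)  = refl
  𝟙-inclusion-exclusion₂ (no _)  (yes _) = refl
  𝟙-inclusion-exclusion₂ (no _)  (no _)  = refl

  𝟙-inclusion-exclusion₃ : ∀ {a b c} {A : Set a} {B : Set b} {C : Set c} (A? : Dec A) (B? : Dec B) (C? : Dec C) →
    𝟙 (¬? A?) * (𝟙 (¬? B?) * 𝟙 (¬? C?)) + 𝟙 A? + 𝟙 B? + 𝟙 C? + 𝟙 A? * (𝟙 B? * 𝟙 C?)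
      ≡ 1 + 𝟙 A? * 𝟙 B? + 𝟙 A? * 𝟙 C? + 𝟙 B? * 𝟙 C?
  𝟙-inclusion-exclusion₃ (yes _) (yes _) (yes _) = refl
  𝟙-inclusion-exclusion₃ (yes _) (yes _) (no _)  = refl
  𝟙-inclusion-exclusion₃ (yes _) (no _)  (yes _) = refl
  𝟙-inclusion-exclusion₃ (yes _) (no _)  (no _)  = refl
  𝟙-inclusion-exclusion₃ (no _)  (yes _) (yes _) = refl
  𝟙-inclusion-exclusion₃ (no _)  (yes _) (no _)  = refl
  𝟙-inclusion-exclusion₃ (no _)  (no _)  (yes _) = refl
  𝟙-inclusion-exclusion₃ (no _)  (no _)  (no _)  = refl

  ∑-𝟙*-unique : ∀ n k {P : ℕ → Set} (P? : ∀ i → Dec (P i)) → k < n → P k → (∀ i → i < n → P i → i ≡ k) →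
          (f : ℕ → ℕ) → ∑[ i < n ] (𝟙 (P? i) * f i) ≡ f k
  ∑-𝟙*-unique (suc n) zero P? _ P0 unique f = begin
    𝟙 (P? 0) * f 0 + ∑[ i < n ] (𝟙 (P? (suc i)) * f (suc i))  ≡⟨ cong₂ _+_ (cong (_* f 0) (𝟙-yes (P? 0) P0)) rest ⟩
    1 * f 0 + 0                                               ≡⟨ trans (+-identityʳ _) (*-identityˡ _) ⟩
    f 0                                                       ∎
    where
      open ≡-Reasoning
      rest : ∑[ i < n ] (𝟙 (P? (suc i)) * f (suc i)) ≡ 0
      rest = trans (∑-cong-< n (λ i i<n → cong (_* f (suc i)) (𝟙-no (P? (suc i)) (λ Pi → 1+n≢0 (unique (suc i) (s≤s i<n) Pi)))))
                   (∑-0 n)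
  ∑-𝟙*-unique (suc n) (suc k) P? (s≤s k<n) Pk unique f =
    trans (cong (λ x → x * f 0 + ∑[ i < n ] (𝟙 (P? (suc i)) * f (suc i))) (𝟙-no (P? 0) (λ P0 → 0≢1+n (unique 0 (s≤s z≤n) P0))))
          (∑-𝟙*-unique n k (λ i → P? (suc i)) k<n Pk (λ i i<n Pi → suc-injective (unique (suc i) (s≤s i<n) Pi)) (λ i → f (suc i)))

  ∑-inclusion-exclusion₂ : ∀ n {A B : ℕ → Set} (A? : ∀ i → Dec (A i)) (B? : ∀ i → Dec (B i)) →
    ∑[ i < n ] (𝟙 (¬? (A? i)) * 𝟙 (¬? (B? i))) + ∑[ i < n ] 𝟙 (A? i) + ∑[ i < n ] 𝟙 (B? i)
      ≡ n + ∑[ i < n ] (𝟙 (A? i) * 𝟙 (B? i))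
  ∑-inclusion-exclusion₂ zero    A? B? = refl
  ∑-inclusion-exclusion₂ (suc n) A? B? =
    trans (shuffle (none 0) (∑[ i < n ] none (suc i)) (a 0) (∑[ i < n ] a (suc i)) (b 0) (∑[ i < n ] b (suc i)))
          (trans (cong₂ _+_ (𝟙-inclusion-exclusion₂ (A? 0) (B? 0))
                            (∑-inclusion-exclusion₂ n (λ i → A? (suc i)) (λ i → B? (suc i))))
                 (unshuffle (ab 0) n (∑[ i < n ] ab (suc i))))
    where
      none a b ab : ℕ → ℕ
      none i = 𝟙 (¬? (A? i)) * 𝟙 (¬? (B? i))
      a i = 𝟙 (A? i)
      b i = 𝟙 (B? i)
      ab i = 𝟙 (A? i) * 𝟙 (B? i)
      shuffle : ∀ x X a A b B → x + X + (a + A) + (b + B) ≡ x + a + b + (X + A + B)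
      shuffle = solve-∀
      unshuffle : ∀ ab n AB → 1 + ab + (n + AB) ≡ suc n + (ab + AB)
      unshuffle = solve-∀

  ∑-inclusion-exclusion₃ : ∀ n {A B C : ℕ → Set} (A? : ∀ i → Dec (A i)) (B? : ∀ i → Dec (B i)) (C? : ∀ i → Dec (C i)) →
    ∑[ i < n ] (𝟙 (¬? (A? i)) * (𝟙 (¬? (B? i)) * 𝟙 (¬? (C? i)))) + ∑[ i < n ] 𝟙 (A? i) + ∑[ i < n ] 𝟙 (B? i) + ∑[ i < n ] 𝟙 (C? i)
      + ∑[ i < n ] (𝟙 (A? i) * (𝟙 (B? i) * 𝟙 (C? i)))
      ≡ n + ∑[ i < n ] (𝟙 (A? i) * 𝟙 (B? i)) + ∑[ i < n ] (𝟙 (A? i) * 𝟙 (C? i)) + ∑[ i < n ] (𝟙 (B? i) * 𝟙 (C? i))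
  ∑-inclusion-exclusion₃ zero    A? B? C? = refl
  ∑-inclusion-exclusion₃ (suc n) A? B? C? =
    trans (shuffle (none 0) (∑[ i < n ] none (suc i)) (a 0) (∑[ i < n ] a (suc i)) (b 0) (∑[ i < n ] b (suc i))
                   (c 0) (∑[ i < n ] c (suc i)) (abc 0) (∑[ i < n ] abc (suc i)))
          (trans (cong₂ _+_ (𝟙-inclusion-exclusion₃ (A? 0) (B? 0) (C? 0))
                            (∑-inclusion-exclusion₃ n (λ i → A? (suc i)) (λ i → B? (suc i)) (λ i → C? (suc i))))
                 (unshuffle (ab 0) (ac 0) (bc 0) n (∑[ i < n ] ab (suc i)) (∑[ i < n ] ac (suc i)) (∑[ i < n ] bc (suc i))))
    where
      none a b c ab ac bc abc : ℕ → ℕ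
      none i = 𝟙 (¬? (A? i)) * (𝟙 (¬? (B? i)) * 𝟙 (¬? (C? i)))
      a i = 𝟙 (A? i)
      b i = 𝟙 (B? i)
      c i = 𝟙 (C? i)
      ab i = 𝟙 (A? i) * 𝟙 (B? i)
      ac i = 𝟙 (A? i) * 𝟙 (C? i)
      bc i = 𝟙 (B? i) * 𝟙 (C? i)
      abc i = 𝟙 (A? i) * (𝟙 (B? i) * 𝟙 (C? i))
      shuffle : ∀ x X a A b B c C d D → x + X + (a + A) + (b + B) + (c + C) + (d + D) ≡ x + a + b + c + d + (X + A + B + C + D)
      shuffle = solve-∀
      unshuffle : ∀ ab ac bc n AB AC BC → 1 + ab + ac + bc + (n + AB + AC + BC) ≡ suc n + (ab + AB) + (ac + AC) + (bc + BC)
      unshuffle = solve-∀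

  ∑³ : ℕ → (ℕ → ℕ → ℕ → ℕ) → ℕ
  ∑³ n f = ∑[ a < n ] ∑[ b < n ] ∑[ c < n ] f a b c

  ∑³-cong : ∀ n {f g : ℕ → ℕ → ℕ → ℕ} → (∀ a b c → f a b c ≡ g a b c) → ∑³ n f ≡ ∑³ n g
  ∑³-cong n eq = ∑-cong n (λ a → ∑-cong n (λ b → ∑-cong n (eq a b)))

  ∑³-*ˡ : ∀ n k (f : ℕ → ℕ → ℕ → ℕ) → ∑³ n (λ a b c → k * f a b c) ≡ k * ∑³ n f
  ∑³-*ˡ n k f = trans (∑-cong n (λ a → trans (∑-cong n (λ b → ∑-*ˡ n k (f a b))) (∑-*ˡ n k (λ b → ∑ n (f a b)))))
                      (∑-*ˡ n k (λ a → ∑[ b < n ] ∑ n (f a b)))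

  ∑³-*ʳ : ∀ n k (f : ℕ → ℕ → ℕ → ℕ) → ∑³ n (λ a b c → f a b c * k) ≡ ∑³ n f * k
  ∑³-*ʳ n k f = trans (∑³-cong n (λ a b c → *-comm (f a b c) k)) (trans (∑³-*ˡ n k f) (*-comm k (∑³ n f)))

  ∑³-const : ∀ n k → ∑³ n (λ _ _ _ → k) ≡ n * n * n * k
  ∑³-const n k = trans (∑-cong n (λ _ → trans (∑-cong n (λ _ → ∑-const n k)) (∑-const n (n * k))))
                       (trans (∑-const n (n * (n * k))) (reassoc n k))
    where
      reassoc : ∀ n k → n * (n * (n * k)) ≡ n * n * n * k
      reassoc = solve-∀

  ∑³-blocks : ∀ m n (f : ℕ → ℕ → ℕ → ℕ) →
    ∑³ (m * n) f ≡ ∑³ n (λ r s t → ∑³ m (λ i j l → f (i * n + r) (j * n + s) (l * n + t)))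
  ∑³-blocks m n f = begin
    ∑³ (m * n) f
      ≡⟨ ∑-blocks m n (λ a → ∑[ b < m * n ] ∑[ c < m * n ] f a b c) ⟩
    ∑[ r < n ] ∑[ i < m ] ∑[ b < m * n ] ∑[ c < m * n ] f (i * n + r) b c
      ≡⟨ ∑-cong n (λ r → ∑-cong m (λ i → ∑-blocks m n (λ b → ∑[ c < m * n ] f (i * n + r) b c))) ⟩
    ∑[ r < n ] ∑[ i < m ] ∑[ s < n ] ∑[ j < m ] ∑[ c < m * n ] f (i * n + r) (j * n + s) c
      ≡⟨ ∑-cong n (λ r → ∑-cong m (λ i → ∑-cong n (λ s → ∑-cong m (λ j → ∑-blocks m n (f (i * n + r) (j * n + s)))))) ⟩
    ∑[ r < n ] ∑[ i < m ] ∑[ s < n ] ∑[ j < m ] ∑[ t < n ] ∑[ l < m ] g r s t i j l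
      ≡⟨ ∑-cong n (λ r → ∑-comm m n (λ i s → ∑[ j < m ] ∑[ t < n ] ∑[ l < m ] g r s t i j l)) ⟩
    ∑[ r < n ] ∑[ s < n ] ∑[ i < m ] ∑[ j < m ] ∑[ t < n ] ∑[ l < m ] g r s t i j l
      ≡⟨ ∑-cong n (λ r → ∑-cong n (λ s → ∑-cong m (λ i → ∑-comm m n (λ j t → ∑[ l < m ] g r s t i j l)))) ⟩
    ∑[ r < n ] ∑[ s < n ] ∑[ i < m ] ∑[ t < n ] ∑[ j < m ] ∑[ l < m ] g r s t i j l
      ≡⟨ ∑-cong n (λ r → ∑-cong n (λ s → ∑-comm m n (λ i t → ∑[ j < m ] ∑[ l < m ] g r s t i j l))) ⟩
    ∑³ n (λ r s t → ∑³ m (g r s t)) ∎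
    where
      open ≡-Reasoning
      g : ℕ → ℕ → ℕ → ℕ → ℕ → ℕ → ℕ
      g r s t i j l = f (i * n + r) (j * n + s) (l * n + t)

  ∑-𝟙-unique : ∀ n k {P : ℕ → Set} {Q : Set} (P? : ∀ i → Dec (P i)) (Q? : Dec Q) → k < n →
               (∀ i → i < n → P i → i ≡ k × Q) → (Q → P k) → ∑[ i < n ] 𝟙 (P? i) ≡ 𝟙 Q?
  ∑-𝟙-unique n k P? (yes q) k<n only-k Q⇒Pk =
    trans (∑-cong n (λ i → sym (*-identityʳ (𝟙 (P? i))))) (∑-𝟙*-unique n k P? k<n (Q⇒Pk q) (λ i i<n Pi → proj₁ (only-k i i<n Pi)) (λ _ → 1))
  ∑-𝟙-unique n k P? (no ¬q) k<n only-k Q⇒Pk =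
    trans (∑-cong-< n (λ i i<n → 𝟙-no (P? i) (λ Pi → ¬q (proj₂ (only-k i i<n Pi))))) (∑-0 n)

open FiniteSums

module Congruences where

  open import Data.Nat as ℕ using (ℕ; zero; suc; NonZero)
  import Data.Nat.Properties as ℕₚ
  open import Data.Nat.Coprimality using (prime⇒coprime; coprime-Bézout)
  open import Data.Nat.Divisibility using (_∣_; divides; ∣⇒≤)
  open import Data.Nat.DivMod using (_%_; _/_; m≡m%n+[m/n]*n; m%n<n)
  open import Data.Nat.GCD using (module Bézout)
  open import Data.Nat.Primality using (Prime; prime⇒nonZero; euclidsLemma)
  open import Data.Integer using (ℤ; +_; -_; _+_; _*_; _-_; ∣_∣)
  import Data.Integer.Properties as ℤₚ
  import Data.Integer.Divisibility.Signed as Signed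
  open import Data.Integer.DivMod using (_%ℕ_; _/ℕ_; n%ℕd<d; a≡a%ℕn+[a/ℕn]*n)
  open import Data.Integer.Tactic.RingSolver using (solve-∀)
  open import Data.Product using (∃; _,_)
  open import Data.Sum using (_⊎_; inj₁; inj₂)
  open import Data.Empty using (⊥-elim)
  open import Function using (_∘_)
  open import Level using (0ℓ)
  open import Relation.Binary.Bundles using (Setoid)
  import Relation.Binary.Reasoning.Setoid as SetoidReasoning
  open import Relation.Binary.PropositionalEquality
  open import Relation.Nullary using (Dec; ¬_)
  open import Relation.Nullary.Decidable using (map′)

  infix 4 _≡_mod_
  record _≡_mod_ (x y : ℤ) (p : ℕ) : Set where
    constructor ≡-mod
    field
      quotient : ℤ
      equation : x ≡ y + quotient * + p

  module _ {p : ℕ} where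

    private
      P = + p

    ≡-mod-refl : ∀ {x} → x ≡ x mod p
    ≡-mod-refl {x} = ≡-mod (+ 0) (sym (ℤₚ.+-identityʳ x))

    ≡⇒≡-mod : ∀ {x y} → x ≡ y → x ≡ y mod p
    ≡⇒≡-mod refl = ≡-mod-refl

    ≡-mod-sym : ∀ {x y} → x ≡ y mod p → y ≡ x mod p
    ≡-mod-sym {y = y} (≡-mod k refl) = ≡-mod (- k) (lemma y k P)
      where
        lemma : ∀ y k P → y ≡ y + k * P + - k * P
        lemma = solve-∀

    ≡-mod-trans : ∀ {x y z} → x ≡ y mod p → y ≡ z mod p → x ≡ z mod p
    ≡-mod-trans {z = z} (≡-mod k refl) (≡-mod l refl) = ≡-mod (l + k) (lemma z k l P)
      where
        lemma : ∀ z k l P → z + l * P + k * P ≡ z + (l + k) * P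
        lemma = solve-∀

    +-cong-mod : ∀ {x y u v} → x ≡ y mod p → u ≡ v mod p → x + u ≡ y + v mod p
    +-cong-mod {y = y} {v = v} (≡-mod k refl) (≡-mod l refl) = ≡-mod (k + l) (lemma y v k l P)
      where
        lemma : ∀ y v k l P → y + k * P + (v + l * P) ≡ y + v + (k + l) * P
        lemma = solve-∀

    *-cong-mod : ∀ {x y u v} → x ≡ y mod p → u ≡ v mod p → x * u ≡ y * v mod p
    *-cong-mod {y = y} {v = v} (≡-mod k refl) (≡-mod l refl) = ≡-mod (k * v + y * l + k * l * P) (lemma y v k l P)
      where
        lemma : ∀ y v k l P → (y + k * P) * (v + l * P) ≡ y * v + (k * v + y * l + k * l * P) * P
        lemma = solve-∀

    neg-cong-mod : ∀ {x y} → x ≡ y mod p → - x ≡ - y mod p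
    neg-cong-mod {y = y} (≡-mod k refl) = ≡-mod (- k) (lemma y k P)
      where
        lemma : ∀ y k P → - (y + k * P) ≡ - y + - k * P
        lemma = solve-∀

    *-zeroˡ-mod : ∀ {x} y → x ≡ + 0 mod p → x * y ≡ + 0 mod p
    *-zeroˡ-mod y x≡0 = ≡-mod-trans (*-cong-mod x≡0 (≡-mod-refl {x = y})) (≡⇒≡-mod (ℤₚ.*-zeroˡ y))

    *-zeroʳ-mod : ∀ x {y} → y ≡ + 0 mod p → x * y ≡ + 0 mod p
    *-zeroʳ-mod x y≡0 = ≡-mod-trans (*-cong-mod (≡-mod-refl {x = x}) y≡0) (≡⇒≡-mod (ℤₚ.*-zeroʳ x))

    ≡-mod⇒-≡0 : ∀ {x y} → x ≡ y mod p → x - y ≡ + 0 mod p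
    ≡-mod⇒-≡0 {y = y} (≡-mod k refl) = ≡-mod k (lemma y k P)
      where
        lemma : ∀ y k P → y + k * P - y ≡ + 0 + k * P
        lemma = solve-∀

    -≡0⇒≡-mod : ∀ {x y} → x - y ≡ + 0 mod p → x ≡ y mod p
    -≡0⇒≡-mod {x} {y} (≡-mod k eq) = ≡-mod k (trans (lemma x y) (cong (λ t → y + t) (trans eq (ℤₚ.+-identityˡ _))))
      where
        lemma : ∀ x y → x ≡ y + (x - y)
        lemma = solve-∀

  ≡-mod-setoid : ℕ → Setoid 0ℓ 0ℓ
  ≡-mod-setoid p = record
    { Carrier       = ℤ
    ; _≈_           = λ x y → x ≡ y mod p
    ; isEquivalence = record { refl = ≡-mod-refl ; sym = ≡-mod-sym ; trans = ≡-mod-trans }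
    }

  module ≡-mod-Reasoning (p : ℕ) = SetoidReasoning (≡-mod-setoid p)

  private
    signed∣⇒≡0-mod : ∀ {p x} → + p Signed.∣ x → x ≡ + 0 mod p
    signed∣⇒≡0-mod (Signed.divides k eq) = ≡-mod k (trans eq (sym (ℤₚ.+-identityˡ _)))

    ≡0-mod⇒signed∣ : ∀ {p x} → x ≡ + 0 mod p → + p Signed.∣ x
    ≡0-mod⇒signed∣ (≡-mod k eq) = Signed.divides k (trans eq (ℤₚ.+-identityˡ _))

  infix 4 _≡?_mod_
  _≡?_mod_ : ∀ x y p → Dec (x ≡ y mod p)
  x ≡? y mod p = map′ (-≡0⇒≡-mod ∘ signed∣⇒≡0-mod) (≡0-mod⇒signed∣ ∘ ≡-mod⇒-≡0) (+ p Signed.∣? (x - y))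

  module _ {p : ℕ} where

    ≡0-mod⇒∣ : ∀ {x} → x ≡ + 0 mod p → p ∣ ∣ x ∣
    ≡0-mod⇒∣ (≡-mod k refl) = divides ∣ k ∣ (trans (cong ∣_∣ (ℤₚ.+-identityˡ (k * + p))) (ℤₚ.abs-* k (+ p)))

    ∣⇒≡0-mod : ∀ {x} → p ∣ ∣ x ∣ → x ≡ + 0 mod p
    ∣⇒≡0-mod = signed∣⇒≡0-mod ∘ Signed.∣ᵤ⇒∣

    ≡-mod-∣ : ∀ {q x y} → q ∣ p → x ≡ y mod p → x ≡ y mod q
    ≡-mod-∣ {q} {y = y} (divides t refl) (≡-mod k refl) =
      ≡-mod (k * + t) (cong (λ u → y + u) (trans (cong (k *_) (ℤₚ.pos-* t q)) (sym (ℤₚ.*-assoc k (+ t) (+ q)))))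

    +-multiple≡-mod : ∀ j r → + (j ℕ.* p ℕ.+ r) ≡ + r mod p
    +-multiple≡-mod j r = ≡-mod (+ j)
      (trans (ℤₚ.pos-+ (j ℕ.* p) r) (trans (ℤₚ.+-comm (+ (j ℕ.* p)) (+ r)) (cong (λ u → + r + u) (ℤₚ.pos-* j p))))

  -- Pairs of congruent integers form a ring: evaluating a polynomial expression on such pairs yields
  -- the congruence between its values at the two components.
  infix 5 _~_∶_
  record Congruent (p : ℕ) : Set where
    constructor _~_∶_
    field
      lhs rhs : ℤ
      lhs≡rhs : lhs ≡ rhs mod p

  open Congruent public using (lhs≡rhs)

  module _ {p : ℕ} where

    infixl 6 _⊕_ _⊝_
    infixl 7 _⊗_

    _⊕_ _⊗_ _⊝_ : Congruent p → Congruent p → Congruent p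
    (x ~ y ∶ x≡y) ⊕ (u ~ v ∶ u≡v) = x + u ~ y + v ∶ +-cong-mod x≡y u≡v
    (x ~ y ∶ x≡y) ⊗ (u ~ v ∶ u≡v) = x * u ~ y * v ∶ *-cong-mod x≡y u≡v
    (x ~ y ∶ x≡y) ⊝ (u ~ v ∶ u≡v) = x - u ~ y - v ∶ +-cong-mod x≡y (neg-cong-mod u≡v)

    ⟦_⟧ : ∀ {x y} → x ≡ y mod p → Congruent p
    ⟦_⟧ {x} {y} x≡y = x ~ y ∶ x≡y

    same : ℤ → Congruent p
    same x = x ~ x ∶ ≡-mod-refl

  module _ {p : ℕ} .{{_ : NonZero p}} where

    residue : ℤ → ℕ
    residue x = x %ℕ p

    residue<p : ∀ x → residue x ℕ.< p
    residue<p x = n%ℕd<d x p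

    ≡-mod-residue : ∀ x → x ≡ + residue x mod p
    ≡-mod-residue x = ≡-mod (x /ℕ p) (a≡a%ℕn+[a/ℕn]*n x p)

    ≡-mod-% : ∀ m → + m ≡ + (m % p) mod p
    ≡-mod-% m = ≡-mod (+ (m / p))
      (trans (cong +_ (m≡m%n+[m/n]*n m p)) (trans (ℤₚ.pos-+ (m % p) _) (cong (λ u → + (m % p) + u) (ℤₚ.pos-* (m / p) p))))

    <-≡-mod⇒≡ : ∀ {i j} → i ℕ.< p → j ℕ.< p → + i ≡ + j mod p → i ≡ j
    <-≡-mod⇒≡ {i} {j} i<p j<p i≡j = ℤₚ.+-injective (ℤₚ.i-j≡0⇒i≡j (+ i) (+ j) (ℤₚ.∣i∣≡0⇒i≡0 ∣i-j∣≡0))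
      where
        p∣i-j : p ∣ ∣ + i - + j ∣
        p∣i-j = ≡0-mod⇒∣ (≡-mod-trans (+-cong-mod i≡j (≡-mod-refl {x = - + j})) (≡⇒≡-mod (ℤₚ.+-inverseʳ (+ j))))
        ∣i-j∣<p : ∣ + i - + j ∣ ℕ.< p
        ∣i-j∣<p = ℕₚ.≤-<-trans (subst (ℕ._≤ i ℕ.⊔ j) (sym (cong ∣_∣ (ℤₚ.[+m]-[+n]≡m⊖n i j))) (ℤₚ.∣m⊝n∣≤m⊔n i j))
                              (ℕₚ.⊔-lub i<p j<p)
        ∣i-j∣≡0 : ∣ + i - + j ∣ ≡ 0
        ∣i-j∣≡0 with ∣ + i - + j ∣ | p∣i-j | ∣i-j∣<p
        ... | zero  | _   | _  = refl
        ... | suc _ | p∣d | d<p = ⊥-elim (ℕₚ.<⇒≱ d<p (∣⇒≤ p∣d))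

    %-≡⇒≡-mod : ∀ m n → m % p ≡ n % p → + m ≡ + n mod p
    %-≡⇒≡-mod m n eq = ≡-mod-trans (≡-mod-% m) (≡-mod-trans (≡⇒≡-mod (cong +_ eq)) (≡-mod-sym (≡-mod-% n)))

    ≡-mod⇒%-≡ : ∀ m n → + m ≡ + n mod p → m % p ≡ n % p
    ≡-mod⇒%-≡ m n m≡n = <-≡-mod⇒≡ (m%n<n m p) (m%n<n n p)
      (≡-mod-trans (≡-mod-sym (≡-mod-% m)) (≡-mod-trans m≡n (≡-mod-% n)))

  private
    pos-1+* : ∀ a b c d → 1 ℕ.+ a ℕ.* b ≡ c ℕ.* d → + 1 + + a * + b ≡ + c * + d
    pos-1+* a b c d eq = trans (cong (λ t → + 1 + t) (sym (ℤₚ.pos-* a b))) (trans (cong +_ eq) (ℤₚ.pos-* c d))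

  module _ {p : ℕ} (p-prime : Prime p) where

    private
      instance
        p≢0 : NonZero p
        p≢0 = prime⇒nonZero p-prime

    ≡-mod-euclid : ∀ {x y} → x * y ≡ + 0 mod p → x ≡ + 0 mod p ⊎ y ≡ + 0 mod p
    ≡-mod-euclid {x} {y} xy≡0 with euclidsLemma ∣ x ∣ ∣ y ∣ p-prime (subst (p ∣_) (ℤₚ.abs-* x y) (≡0-mod⇒∣ xy≡0))
    ... | inj₁ p∣x = inj₁ (∣⇒≡0-mod p∣x)
    ... | inj₂ p∣y = inj₂ (∣⇒≡0-mod p∣y)

    ≢0-mod-* : ∀ {x y} → ¬ x ≡ + 0 mod p → ¬ y ≡ + 0 mod p → ¬ x * y ≡ + 0 mod p
    ≢0-mod-* x≢0 y≢0 xy≡0 with ≡-mod-euclid xy≡0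
    ... | inj₁ x≡0 = x≢0 x≡0
    ... | inj₂ y≡0 = y≢0 y≡0

    ≡-mod-inverse : ∀ {x} → ¬ x ≡ + 0 mod p → ∃ λ y → x * y ≡ + 1 mod p
    ≡-mod-inverse {x} x≢0 = invert (residue x) (≡-mod-residue x) (residue<p x)
      where
        invert : ∀ r → x ≡ + r mod p → r ℕ.< p → ∃ λ y → x * y ≡ + 1 mod p
        invert zero x≡0 _ = ⊥-elim (x≢0 x≡0)
        invert r@(suc _) x≡r r<p with coprime-Bézout (prime⇒coprime p-prime r<p)
        ... | Bézout.+- a b eq =
          - + b , ≡-mod-trans (*-cong-mod x≡r ≡-mod-refl) (≡-mod (- + a) (lemma (+ r) (+ a) (+ b) (+ p) (pos-1+* b r a p eq)))
          where
            lemma : ∀ r a b P → + 1 + b * r ≡ a * P → r * - b ≡ + 1 + - a * P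
            lemma r a b P eq = trans (ℤ-identity₁ r b) (trans (cong (λ t → + 1 - t) eq) (ℤ-identity₂ a P))
              where
                ℤ-identity₁ : ∀ r b → r * - b ≡ + 1 - (+ 1 + b * r)
                ℤ-identity₁ = solve-∀
                ℤ-identity₂ : ∀ a P → + 1 - a * P ≡ + 1 + - a * P
                ℤ-identity₂ = solve-∀
        ... | Bézout.-+ a b eq =
          + b , ≡-mod-trans (*-cong-mod x≡r ≡-mod-refl) (≡-mod (+ a) (trans (ℤₚ.*-comm (+ r) (+ b)) (sym (pos-1+* a p b r eq))))

open Congruences

module Polynomial where

  open import Data.Nat using (ℕ)
  open import Data.Integer using (ℤ; _+_; _*_; _-_)

  -- Both gcd conditions in g₄ together say that no prime divisor of n divides Q a b c d = abcd·e₃(a,b,c,d);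
  -- Qᴹ eliminates d through the constraint a + b + c + d = M.
  Q : ℤ → ℤ → ℤ → ℤ → ℤ
  Q a b c d = a * b * c * d * (a * b * c + a * b * d + a * c * d + b * c * d)

  Qᴹ : ℤ → ℤ → ℤ → ℤ → ℤ
  Qᴹ M a b c = Q a b c (M - a - b - c)

  module _ {q : ℕ} {a a′ b b′ c c′ : ℤ} (a≡a′ : a ≡ a′ mod q) (b≡b′ : b ≡ b′ mod q) (c≡c′ : c ≡ c′ mod q) where

    Q-cong-mod : ∀ {d d′} → d ≡ d′ mod q → Q a b c d ≡ Q a′ b′ c′ d′ mod q
    Q-cong-mod d≡d′ = lhs≡rhs (A ⊗ B ⊗ C ⊗ D ⊗ (A ⊗ B ⊗ C ⊕ A ⊗ B ⊗ D ⊕ A ⊗ C ⊗ D ⊕ B ⊗ C ⊗ D))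
      where
        A = ⟦ a≡a′ ⟧
        B = ⟦ b≡b′ ⟧
        C = ⟦ c≡c′ ⟧
        D = ⟦ d≡d′ ⟧

    Qᴹ-cong-mod : ∀ {M M′} → M ≡ M′ mod q → Qᴹ M a b c ≡ Qᴹ M′ a′ b′ c′ mod q
    Qᴹ-cong-mod M≡M′ = Q-cong-mod (lhs≡rhs (⟦ M≡M′ ⟧ ⊝ ⟦ a≡a′ ⟧ ⊝ ⟦ b≡b′ ⟧ ⊝ ⟦ c≡c′ ⟧))

open Polynomial

module ResidueSums {p : ℕ} (p-prime : Prime p) where

  open import Data.Nat as ℕ using (ℕ; NonZero)
  open import Data.Nat.Primality using (Prime; prime⇒nonZero; ¬prime[1])
  open import Data.Nat.Divisibility using (∣1⇒≡1)
  import Data.Nat.Properties as ℕₚ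
  open import Algebra.Properties.CommutativeSemigroup ℕₚ.*-commutativeSemigroup using (x∙yz≈y∙xz)
  open import Data.Integer using (ℤ; +_; -_; _+_; _*_; _-_)
  import Data.Integer.Properties as ℤₚ
  open import Data.Integer.Tactic.RingSolver using (solve-∀)
  open import Data.Nat.Tactic.RingSolver renaming (solve-∀ to ℕ-solve-∀)
  open import Data.Product using (proj₁; proj₂)
  open import Data.Sum using (_⊎_; inj₂; [_,_]′)
  open import Data.Empty using (⊥-elim)
  open import Relation.Binary.PropositionalEquality
  open import Relation.Nullary using (yes; no; ¬_)
  open import Relation.Nullary.Decidable using (¬?)

  private
    instance
      p≢0 : NonZero p
      p≢0 = prime⇒nonZero p-prime

  Periodic : (ℤ → ℕ) → Set
  Periodic f = ∀ {x y} → x ≡ y mod p → f x ≡ f y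

  ∑ᵣ : (ℤ → ℕ) → ℕ
  ∑ᵣ f = ∑[ i < p ] f (+ i)

  syntax ∑ᵣ (λ x → e) = ∑ᵣ[ x ] e

  ∑ᵣ-cong : ∀ {f g : ℤ → ℕ} → (∀ x → f x ≡ g x) → ∑ᵣ f ≡ ∑ᵣ g
  ∑ᵣ-cong eq = ∑-cong p (λ i → eq (+ i))

  ∑ᵣ-1 : ∑ᵣ[ _ ] 1 ≡ p
  ∑ᵣ-1 = trans (∑-const p 1) (ℕₚ.*-identityʳ p)

  ∑ᵣ-periodic : ∀ (F : ℤ → ℤ → ℕ) → (∀ y → Periodic (λ x → F x y)) → Periodic (λ x → ∑ᵣ[ y ] F x y)
  ∑ᵣ-periodic F F-periodic {x} {x′} x≡x′ = ∑ᵣ-cong {F x} {F x′} (λ y → F-periodic y x≡x′)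

  δ : ℤ → ℤ → ℕ
  δ x y = 𝟙 (x ≡? y mod p)

  δ₀ : ℤ → ℕ
  δ₀ x = δ x (+ 0)

  𝟙[≢0] : ℤ → ℕ
  𝟙[≢0] x = 𝟙 (¬? (x ≡? + 0 mod p))

  δ-⇔ : ∀ {x y u v} → (x ≡ y mod p → u ≡ v mod p) → (u ≡ v mod p → x ≡ y mod p) → δ x y ≡ δ u v
  δ-⇔ {x} {y} {u} {v} = 𝟙-⇔ (x ≡? y mod p) (u ≡? v mod p)

  δ-periodic : ∀ y → Periodic (λ x → δ x y)
  δ-periodic y x≡x′ = δ-⇔ (≡-mod-trans (≡-mod-sym x≡x′)) (≡-mod-trans x≡x′)

  𝟙[≢0]-periodic : Periodic 𝟙[≢0]
  𝟙[≢0]-periodic {x} {x′} x≡x′ =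
    𝟙-⇔ (¬? (x ≡? + 0 mod p)) (¬? (x′ ≡? + 0 mod p)) (λ x≢0 x′≡0 → x≢0 (≡-mod-trans x≡x′ x′≡0))
                                                      (λ x′≢0 x≡0 → x′≢0 (≡-mod-trans (≡-mod-sym x≡x′) x≡0))

  affine-periodic : ∀ q r (g : ℤ → ℕ) → Periodic g → Periodic (λ z → g (q * z + r))
  affine-periodic q r g g-periodic z≡z′ = g-periodic (lhs≡rhs (same q ⊗ ⟦ z≡z′ ⟧ ⊕ same r))

  𝟙[≢0]+δ₀ : ∀ x → 𝟙[≢0] x ℕ.+ δ₀ x ≡ 1
  𝟙[≢0]+δ₀ x = 𝟙-¬-+ (x ≡? + 0 mod p)

  𝟙[≢0]-nonzero : ∀ {x} → ¬ x ≡ + 0 mod p → 𝟙[≢0] x ≡ 1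
  𝟙[≢0]-nonzero {x} x≢0 = 𝟙-yes (¬? (x ≡? + 0 mod p)) x≢0

  𝟙[≢0]-zero : ∀ {x} → x ≡ + 0 mod p → 𝟙[≢0] x ≡ 0
  𝟙[≢0]-zero {x} x≡0 = 𝟙-no (¬? (x ≡? + 0 mod p)) (λ x≢0 → x≢0 x≡0)

  δ₀-nonzero : ∀ {x} → ¬ x ≡ + 0 mod p → δ₀ x ≡ 0
  δ₀-nonzero {x} = 𝟙-no (x ≡? + 0 mod p)

  1≢0-mod : ¬ + 1 ≡ + 0 mod p
  1≢0-mod 1≡0 = ¬prime[1] (subst Prime (∣1⇒≡1 (≡0-mod⇒∣ 1≡0)) p-prime)

  δ₀-+ : ∀ z s → δ₀ (z + s) ≡ δ z (- s)
  δ₀-+ z s = δ-⇔ (λ z+s≡0 → -≡0⇒≡-mod (≡-mod-trans (≡⇒≡-mod (ℤ-identity z s)) z+s≡0))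
                 (λ z≡-s → ≡-mod-trans (≡⇒≡-mod (sym (ℤ-identity z s))) (≡-mod⇒-≡0 z≡-s))
    where
      ℤ-identity : ∀ z s → z - - s ≡ z + s
      ℤ-identity = solve-∀

  δ₀-neg : ∀ x → δ₀ (- x) ≡ δ₀ x
  δ₀-neg x = δ-⇔ (λ -x≡0 → ≡-mod-trans (≡⇒≡-mod (sym (ℤₚ.neg-involutive x))) (neg-cong-mod -x≡0)) neg-cong-mod

  𝟙[≢0]-* : ∀ x y → 𝟙[≢0] (x * y) ≡ 𝟙[≢0] x ℕ.* 𝟙[≢0] y
  𝟙[≢0]-* x y with x ≡? + 0 mod p | y ≡? + 0 mod p
  ... | yes x≡0 | _       = 𝟙[≢0]-zero (*-zeroˡ-mod y x≡0)
  ... | no _    | yes y≡0 = 𝟙[≢0]-zero (*-zeroʳ-mod x y≡0)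
  ... | no x≢0  | no y≢0  = 𝟙[≢0]-nonzero (≢0-mod-* p-prime x≢0 y≢0)

  𝟙[≢0]-*-unit : ∀ {a} → ¬ a ≡ + 0 mod p → ∀ x → 𝟙[≢0] (a * x) ≡ 𝟙[≢0] x
  𝟙[≢0]-*-unit {a} a≢0 x = trans (𝟙[≢0]-* a x) (trans (cong (ℕ._* 𝟙[≢0] x) (𝟙[≢0]-nonzero a≢0)) (ℕₚ.*-identityˡ (𝟙[≢0] x)))

  ∑ᵣ-δ-* : ∀ t (f : ℤ → ℕ) → Periodic f → ∑ᵣ[ y ] (δ y t ℕ.* f y) ≡ f t
  ∑ᵣ-δ-* t f f-periodic =
    trans (∑-𝟙*-unique p (residue t) (λ i → + i ≡? t mod p) (residue<p t) (≡-mod-sym (≡-mod-residue t))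
                 (λ i i<p i≡t → <-≡-mod⇒≡ i<p (residue<p t) (≡-mod-trans i≡t (≡-mod-residue t))) (λ i → f (+ i)))
          (f-periodic (≡-mod-sym (≡-mod-residue t)))

  ∑ᵣ-δ : ∀ t → ∑ᵣ[ y ] δ y t ≡ 1
  ∑ᵣ-δ t = trans (∑ᵣ-cong (λ y → sym (ℕₚ.*-identityʳ (δ y t)))) (∑ᵣ-δ-* t (λ _ → 1) (λ _ → refl))

  ∑ᵣ-𝟙[≢0] : ∑ᵣ 𝟙[≢0] ℕ.+ 1 ≡ p
  ∑ᵣ-𝟙[≢0] = begin
    ∑ᵣ 𝟙[≢0] ℕ.+ 1                         ≡⟨ cong (∑ᵣ 𝟙[≢0] ℕ.+_) (sym (∑ᵣ-δ (+ 0))) ⟩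
    ∑ᵣ 𝟙[≢0] ℕ.+ ∑ᵣ δ₀                     ≡⟨ sym (∑-+ p (λ i → 𝟙[≢0] (+ i)) (λ i → δ₀ (+ i))) ⟩
    ∑ᵣ[ x ] (𝟙[≢0] x ℕ.+ δ₀ x)             ≡⟨ ∑ᵣ-cong 𝟙[≢0]+δ₀ ⟩
    ∑ᵣ[ _ ] 1                              ≡⟨ ∑ᵣ-1 ⟩
    p                                      ∎
    where open ≡-Reasoning

  module _ {a : ℤ} (a≢0 : ¬ a ≡ + 0 mod p) where

    private
      a⁻¹ : ℤ
      a⁻¹ = proj₁ (≡-mod-inverse p-prime a≢0)

      a*a⁻¹≡1 : a * a⁻¹ ≡ + 1 mod p
      a*a⁻¹≡1 = proj₂ (≡-mod-inverse p-prime a≢0)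

      root : ℤ → ℤ
      root b = - b * a⁻¹

      root⇒ : ∀ {x} b → a * x + b ≡ + 0 mod p → x ≡ root b mod p
      root⇒ {x} b ax+b≡0 = begin
        x                                   ≡⟨ ℤ-identity₁ x ⟩
        + 1 * x                             ≈⟨ *-cong-mod (≡-mod-sym a*a⁻¹≡1) ≡-mod-refl ⟩
        a * a⁻¹ * x                         ≡⟨ ℤ-identity₂ a a⁻¹ x b ⟩
        a⁻¹ * (a * x + b) + root b          ≈⟨ +-cong-mod (*-zeroʳ-mod a⁻¹ ax+b≡0) ≡-mod-refl ⟩
        + 0 + root b                        ≡⟨ ℤₚ.+-identityˡ (root b) ⟩
        root b                              ∎
        where
          open ≡-mod-Reasoning p
          ℤ-identity₁ : ∀ x → x ≡ + 1 * x
          ℤ-identity₁ = solve-∀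
          ℤ-identity₂ : ∀ a a⁻¹ x b → a * a⁻¹ * x ≡ a⁻¹ * (a * x + b) + - b * a⁻¹
          ℤ-identity₂ = solve-∀

      root⇐ : ∀ {x} b → x ≡ root b mod p → a * x + b ≡ + 0 mod p
      root⇐ {x} b x≡root = begin
        a * x + b                           ≈⟨ +-cong-mod (*-cong-mod (≡-mod-refl {x = a}) x≡root) ≡-mod-refl ⟩
        a * root b + b                      ≡⟨ ℤ-identity a a⁻¹ b ⟩
        a * a⁻¹ * - b + b                   ≈⟨ +-cong-mod (*-cong-mod a*a⁻¹≡1 ≡-mod-refl) ≡-mod-refl ⟩
        + 1 * - b + b                       ≡⟨ ℤ-inverse b ⟩
        + 0                                 ∎
        where
          open ≡-mod-Reasoning p
          ℤ-identity : ∀ a a⁻¹ b → a * (- b * a⁻¹) + b ≡ a * a⁻¹ * - b + b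
          ℤ-identity = solve-∀
          ℤ-inverse : ∀ b → + 1 * - b + b ≡ + 0
          ℤ-inverse = solve-∀

    ∑ᵣ-δ₀-linear : ∀ b → ∑ᵣ[ x ] δ₀ (a * x + b) ≡ 1
    ∑ᵣ-δ₀-linear b = trans (∑ᵣ-cong {g = λ x → δ x (root b)} (λ x → δ-⇔ (root⇒ b) (root⇐ b))) (∑ᵣ-δ (root b))

    ∑ᵣ-affine : ∀ s (f : ℤ → ℕ) → Periodic f → ∑ᵣ[ y ] f (s + a * y) ≡ ∑ᵣ f
    ∑ᵣ-affine s f f-periodic = begin
      ∑ᵣ[ y ] f (s + a * y)                              ≡⟨ ∑ᵣ-cong (λ y → sym (∑ᵣ-δ-* (s + a * y) f f-periodic)) ⟩
      ∑ᵣ[ y ] ∑ᵣ[ z ] (δ z (s + a * y) ℕ.* f z)          ≡⟨ ∑-comm p p (λ i j → δ (+ j) (s + a * + i) ℕ.* f (+ j)) ⟩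
      ∑ᵣ[ z ] ∑ᵣ[ y ] (δ z (s + a * y) ℕ.* f z)          ≡⟨ ∑ᵣ-cong (λ z → ∑-*ʳ p (f z) (λ i → δ z (s + a * + i))) ⟩
      ∑ᵣ[ z ] (∑ᵣ[ y ] δ z (s + a * y) ℕ.* f z)          ≡⟨ ∑ᵣ-cong (λ z → cong (ℕ._* f z) (hits-once z)) ⟩
      ∑ᵣ[ z ] (1 ℕ.* f z)                               ≡⟨ ∑ᵣ-cong (λ z → ℕₚ.*-identityˡ (f z)) ⟩
      ∑ᵣ f                                              ∎
      where
        open ≡-Reasoning
        ℤ-identity : ∀ s a y z → s + a * y - z ≡ a * y + (s - z)
        ℤ-identity = solve-∀
        hits-once : ∀ z → ∑ᵣ[ y ] δ z (s + a * y) ≡ 1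
        hits-once z = trans (∑ᵣ-cong {g = λ y → δ₀ (a * y + (s - z))} (λ y → δ-⇔ (to y) (from y))) (∑ᵣ-δ₀-linear (s - z))
          where
            to : ∀ y → z ≡ s + a * y mod p → a * y + (s - z) ≡ + 0 mod p
            to y z≡ = ≡-mod-trans (≡⇒≡-mod (sym (ℤ-identity s a y z))) (≡-mod⇒-≡0 (≡-mod-sym z≡))
            from : ∀ y → a * y + (s - z) ≡ + 0 mod p → z ≡ s + a * y mod p
            from y ≡0 = ≡-mod-sym (-≡0⇒≡-mod (≡-mod-trans (≡⇒≡-mod (ℤ-identity s a y z)) ≡0))

    ∑ᵣ-scale : ∀ (f : ℤ → ℕ) → Periodic f → ∑ᵣ[ y ] f (a * y) ≡ ∑ᵣ f
    ∑ᵣ-scale f f-periodic = trans (∑ᵣ-cong (λ y → cong f (sym (ℤₚ.+-identityˡ (a * y))))) (∑ᵣ-affine (+ 0) f f-periodic)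

  ∑ᵣ-δ₀-linear′ : ∀ q r → ¬ q ≡ + 0 mod p ⊎ ¬ r ≡ + 0 mod p → ∑ᵣ[ z ] δ₀ (q * z + r) ≡ 𝟙[≢0] q
  ∑ᵣ-δ₀-linear′ q r q≢0∨r≢0 with q ≡? + 0 mod p
  ... | no q≢0  = ∑ᵣ-δ₀-linear q≢0 r
  ... | yes q≡0 = trans (∑ᵣ-cong (λ z → δ₀-nonzero (λ qz+r≡0 → r≢0 (≡-mod-trans (≡-mod-sym (qz+r≡r z)) qz+r≡0)))) (∑-0 p)
    where
      r≢0 : ¬ r ≡ + 0 mod p
      r≢0 = [ (λ q≢0 → ⊥-elim (q≢0 q≡0)) , (λ r≢0 → r≢0) ]′ q≢0∨r≢0
      qz+r≡r : ∀ z → q * z + r ≡ r mod p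
      qz+r≡r z = ≡-mod-trans (+-cong-mod (*-zeroˡ-mod z q≡0) ≡-mod-refl) (≡⇒≡-mod (ℤₚ.+-identityˡ r))

  ∑ᵤ : (ℤ → ℕ) → ℕ
  ∑ᵤ f = ∑ᵣ[ x ] (𝟙[≢0] x ℕ.* f x)

  syntax ∑ᵤ (λ x → e) = ∑ᵤ[ x ] e

  ∑ᵤ-cong : ∀ {f g : ℤ → ℕ} → (∀ x → ¬ x ≡ + 0 mod p → f x ≡ g x) → ∑ᵤ f ≡ ∑ᵤ g
  ∑ᵤ-cong {f} {g} eq = ∑ᵣ-cong on-units
    where
      on-units : ∀ x → 𝟙[≢0] x ℕ.* f x ≡ 𝟙[≢0] x ℕ.* g x
      on-units x with x ≡? + 0 mod p
      ... | yes _  = refl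
      ... | no x≢0 = cong (1 ℕ.*_) (eq x x≢0)

  ∑ᵤ-+ : ∀ (f g : ℤ → ℕ) → ∑ᵤ[ x ] (f x ℕ.+ g x) ≡ ∑ᵤ f ℕ.+ ∑ᵤ g
  ∑ᵤ-+ f g = trans (∑ᵣ-cong (λ x → ℕₚ.*-distribˡ-+ (𝟙[≢0] x) (f x) (g x)))
                   (∑-+ p (λ i → 𝟙[≢0] (+ i) ℕ.* f (+ i)) (λ i → 𝟙[≢0] (+ i) ℕ.* g (+ i)))

  ∑ᵤ-+-≡ : ∀ (f g h l : ℤ → ℕ) → (∀ x → ¬ x ≡ + 0 mod p → f x ℕ.+ g x ≡ h x ℕ.+ l x) → ∑ᵤ f ℕ.+ ∑ᵤ g ≡ ∑ᵤ h ℕ.+ ∑ᵤ l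
  ∑ᵤ-+-≡ f g h l eq = trans (sym (∑ᵤ-+ f g)) (trans (∑ᵤ-cong eq) (∑ᵤ-+ h l))

  ∑ᵤ-*ˡ : ∀ c (f : ℤ → ℕ) → ∑ᵤ[ x ] (c ℕ.* f x) ≡ c ℕ.* ∑ᵤ f
  ∑ᵤ-*ˡ c f = trans (∑ᵣ-cong (λ x → x∙yz≈y∙xz (𝟙[≢0] x) c (f x))) (∑-*ˡ p c (λ i → 𝟙[≢0] (+ i) ℕ.* f (+ i)))

  ∑ᵤ-const : ∀ c → ∑ᵤ[ _ ] c ≡ ∑ᵣ 𝟙[≢0] ℕ.* c
  ∑ᵤ-const c = ∑-*ʳ p c (λ i → 𝟙[≢0] (+ i))

  ∑ᵤ-δ : ∀ t → ∑ᵤ[ x ] δ x t ≡ 𝟙[≢0] t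
  ∑ᵤ-δ t = trans (∑ᵣ-cong (λ x → ℕₚ.*-comm (𝟙[≢0] x) (δ x t))) (∑ᵣ-δ-* t 𝟙[≢0] 𝟙[≢0]-periodic)

  nonvanishing-count₂ : ∀ q r → ¬ q ≡ + 0 mod p ⊎ ¬ r ≡ + 0 mod p →
    ∑ᵤ[ z ] 𝟙[≢0] (q * z + r) ℕ.+ 1 ℕ.+ 𝟙[≢0] q ≡ p ℕ.+ δ₀ r
  nonvanishing-count₂ q r q≢0∨r≢0 = begin
    ∑ᵤ[ z ] 𝟙[≢0] (q * z + r) ℕ.+ 1 ℕ.+ 𝟙[≢0] q
      ≡⟨ cong₂ (λ u v → ∑ᵤ[ z ] 𝟙[≢0] (q * z + r) ℕ.+ u ℕ.+ v) (sym (∑ᵣ-δ (+ 0))) (sym (∑ᵣ-δ₀-linear′ q r q≢0∨r≢0)) ⟩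
    ∑ᵤ[ z ] 𝟙[≢0] (q * z + r) ℕ.+ ∑ᵣ δ₀ ℕ.+ ∑ᵣ[ z ] δ₀ (q * z + r)
      ≡⟨ ∑-inclusion-exclusion₂ p (λ i → + i ≡? + 0 mod p) (λ i → q * + i + r ≡? + 0 mod p) ⟩
    p ℕ.+ ∑ᵣ[ z ] (δ₀ z ℕ.* δ₀ (q * z + r))
      ≡⟨ cong (p ℕ.+_) (∑ᵣ-δ-* (+ 0) (λ z → δ₀ (q * z + r)) (affine-periodic q r δ₀ (δ-periodic (+ 0)))) ⟩
    p ℕ.+ δ₀ (q * + 0 + r)
      ≡⟨ cong (λ t → p ℕ.+ δ₀ t) (ℤ-identity q r) ⟩
    p ℕ.+ δ₀ r ∎
    where
      open ≡-Reasoning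
      ℤ-identity : ∀ q r → q * + 0 + r ≡ r
      ℤ-identity = solve-∀

  -- Inclusion–exclusion over the zero sets of z, z + σ and q z + r: since r ≢ 0, the only intersections
  -- that can be nonempty are {0} (when σ ≡ 0) and {-σ} (when q (-σ) + r ≡ 0).
  nonvanishing-count₃ : ∀ σ q r → ¬ r ≡ + 0 mod p →
    ∑ᵤ[ z ] (𝟙[≢0] (z + σ) ℕ.* 𝟙[≢0] (q * z + r)) ℕ.+ 𝟙[≢0] σ ℕ.+ 𝟙[≢0] q ℕ.+ 1
      ≡ p ℕ.+ δ₀ (q * - σ + r)
  nonvanishing-count₃ σ q r r≢0 = ℕₚ.+-cancelʳ-≡ (δ₀ σ) _ _ (begin
    N ℕ.+ 𝟙[≢0] σ ℕ.+ 𝟙[≢0] q ℕ.+ 1 ℕ.+ δ₀ σ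
      ≡⟨ shuffle N (𝟙[≢0] σ) (𝟙[≢0] q) (δ₀ σ) ⟩
    N ℕ.+ (𝟙[≢0] σ ℕ.+ δ₀ σ) ℕ.+ 1 ℕ.+ 𝟙[≢0] q ℕ.+ 0
      ≡⟨ cong₂ (λ u v → N ℕ.+ u ℕ.+ 1 ℕ.+ 𝟙[≢0] q ℕ.+ v) (𝟙[≢0]+δ₀ σ) (sym ∑ABC≡0) ⟩
    N ℕ.+ 1 ℕ.+ 1 ℕ.+ 𝟙[≢0] q ℕ.+ ∑ᵣ ABC
      ≡⟨ cong₂ (λ u v → N ℕ.+ u ℕ.+ v ℕ.+ 𝟙[≢0] q ℕ.+ ∑ᵣ ABC) (sym (∑ᵣ-δ (+ 0))) (sym ∑B≡1) ⟩
    N ℕ.+ ∑ᵣ A ℕ.+ ∑ᵣ B ℕ.+ 𝟙[≢0] q ℕ.+ ∑ᵣ ABC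
      ≡⟨ cong (λ u → N ℕ.+ ∑ᵣ A ℕ.+ ∑ᵣ B ℕ.+ u ℕ.+ ∑ᵣ ABC) (sym (∑ᵣ-δ₀-linear′ q r (inj₂ r≢0))) ⟩
    N ℕ.+ ∑ᵣ A ℕ.+ ∑ᵣ B ℕ.+ ∑ᵣ C ℕ.+ ∑ᵣ ABC
      ≡⟨ ∑-inclusion-exclusion₃ p (λ i → + i ≡? + 0 mod p) (λ i → + i + σ ≡? + 0 mod p) (λ i → q * + i + r ≡? + 0 mod p) ⟩
    p ℕ.+ ∑ᵣ AB ℕ.+ ∑ᵣ AC ℕ.+ ∑ᵣ BC
      ≡⟨ cong₂ (λ u v → p ℕ.+ u ℕ.+ v ℕ.+ ∑ᵣ BC) ∑AB≡δ₀σ ∑AC≡0 ⟩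
    p ℕ.+ δ₀ σ ℕ.+ 0 ℕ.+ ∑ᵣ BC
      ≡⟨ cong (λ u → p ℕ.+ δ₀ σ ℕ.+ 0 ℕ.+ u) ∑BC≡δ₀[-qσ+r] ⟩
    p ℕ.+ δ₀ σ ℕ.+ 0 ℕ.+ δ₀ (q * - σ + r)
      ≡⟨ unshuffle p (δ₀ σ) (δ₀ (q * - σ + r)) ⟩
    p ℕ.+ δ₀ (q * - σ + r) ℕ.+ δ₀ σ ∎)
    where
      open ≡-Reasoning
      A B C : ℤ → ℕ
      A z = δ₀ z
      B z = δ₀ (z + σ)
      C z = δ₀ (q * z + r)
      AB AC BC ABC : ℤ → ℕ
      AB z = A z ℕ.* B z
      AC z = A z ℕ.* C z
      BC z = B z ℕ.* C z
      ABC z = A z ℕ.* (B z ℕ.* C z)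
      N : ℕ
      N = ∑ᵤ[ z ] (𝟙[≢0] (z + σ) ℕ.* 𝟙[≢0] (q * z + r))
      B-periodic : Periodic B
      B-periodic z≡z′ = δ-periodic (+ 0) (+-cong-mod z≡z′ ≡-mod-refl)
      C-periodic : Periodic C
      C-periodic = affine-periodic q r δ₀ (δ-periodic (+ 0))
      C0≡0 : C (+ 0) ≡ 0
      C0≡0 = trans (cong δ₀ (ℤ-identity q r)) (δ₀-nonzero r≢0)
        where
          ℤ-identity : ∀ q r → q * + 0 + r ≡ r
          ℤ-identity = solve-∀
      ∑B≡1 : ∑ᵣ B ≡ 1
      ∑B≡1 = trans (∑ᵣ-cong (λ z → δ₀-+ z σ)) (∑ᵣ-δ (- σ))
      ∑ABC≡0 : ∑ᵣ ABC ≡ 0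
      ∑ABC≡0 = trans (∑ᵣ-δ-* (+ 0) BC (λ z≡z′ → cong₂ ℕ._*_ (B-periodic z≡z′) (C-periodic z≡z′)))
                   (trans (cong (B (+ 0) ℕ.*_) C0≡0) (ℕₚ.*-zeroʳ (B (+ 0))))
      ∑AB≡δ₀σ : ∑ᵣ AB ≡ δ₀ σ
      ∑AB≡δ₀σ = trans (∑ᵣ-δ-* (+ 0) B B-periodic) (cong δ₀ (ℤₚ.+-identityˡ σ))
      ∑AC≡0 : ∑ᵣ AC ≡ 0
      ∑AC≡0 = trans (∑ᵣ-δ-* (+ 0) C C-periodic) C0≡0
      ∑BC≡δ₀[-qσ+r] : ∑ᵣ BC ≡ δ₀ (q * - σ + r)
      ∑BC≡δ₀[-qσ+r] = trans (∑ᵣ-cong (λ z → cong (ℕ._* C z) (δ₀-+ z σ))) (∑ᵣ-δ-* (- σ) C C-periodic)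
      shuffle : ∀ N nσ nq eσ → N ℕ.+ nσ ℕ.+ nq ℕ.+ 1 ℕ.+ eσ ≡ N ℕ.+ (nσ ℕ.+ eσ) ℕ.+ 1 ℕ.+ nq ℕ.+ 0
      shuffle = ℕ-solve-∀
      unshuffle : ∀ p eσ E → p ℕ.+ eσ ℕ.+ 0 ℕ.+ E ≡ p ℕ.+ E ℕ.+ eσ
      unshuffle = ℕ-solve-∀

module AffineCount {p : ℕ} (p-prime : Prime p) where

  open import Data.Nat as ℕ using (ℕ; NonZero; z≤n; s≤s)
  import Data.Nat.Properties as ℕₚ
  open import Data.Nat.Primality using (prime⇒nonZero)
  open import Data.Nat.Tactic.RingSolver renaming (solve-∀ to ℕ-solve-∀)
  open import Data.Integer using (ℤ; +_; -_; _+_; _*_; _-_)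
  import Data.Integer.Properties as ℤₚ
  open import Data.Integer.Tactic.RingSolver using (solve-∀)
  open import Data.Sum using (inj₁; inj₂)
  open import Relation.Binary.PropositionalEquality
  open import Relation.Nullary using (¬_)
  open ResidueSums p-prime

  affineCount : ℕ
  affineCount = ∑ᵣ[ x ] ∑ᵣ[ y ] ∑ᵣ[ z ] (𝟙[≢0] (+ 1 + x + y + z) ℕ.* 𝟙[≢0] (Q (+ 1) x y z))

  private
    instance
      p≢0 : NonZero p
      p≢0 = prime⇒nonZero p-prime

    -1≢0 : ¬ - + 1 ≡ + 0 mod p
    -1≢0 -1≡0 = 1≢0-mod (neg-cong-mod -1≡0)

    𝟙[≢0]1≡1 : 𝟙[≢0] (+ 1) ≡ 1
    𝟙[≢0]1≡1 = 𝟙[≢0]-nonzero 1≢0-mod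

    solve-for : ∀ {X e′} c e → X ℕ.+ c ≡ e′ → e′ ≡ e ℕ.+ c → X ≡ e
    solve-for c e eq e′≡e+c = ℕₚ.+-cancelʳ-≡ c _ e (trans eq e′≡e+c)

    1*x+c : ∀ x c → x + c ≡ + 1 * x + c
    1*x+c = solve-∀

    σ q r P : ℤ → ℤ → ℤ
    σ x y = + 1 + x + y
    q x y = x * y + x + y
    r x y = x * y
    P x y = (x + y) * (x + + 1) * (y + + 1)

  module _ (k : ℕ) (p≡3+k : p ≡ 3 ℕ.+ k) where

    private
      2≢0 : ¬ + 2 ≡ + 0 mod p
      2≢0 2≡0 with <-≡-mod⇒≡ (subst (2 ℕ.<_) (sym p≡3+k) (ℕₚ.m≤m+n 3 k)) (subst (0 ℕ.<_) (sym p≡3+k) (s≤s z≤n)) 2≡0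
      ... | ()

    #units : ∑ᵣ 𝟙[≢0] ≡ 2 ℕ.+ k
    #units = solve-for 1 (2 ℕ.+ k) ∑ᵣ-𝟙[≢0] (trans p≡3+k (ℕₚ.+-comm 1 (2 ℕ.+ k)))

    ∑ᵤ-const′ : ∀ c → ∑ᵤ[ _ ] c ≡ (2 ℕ.+ k) ℕ.* c
    ∑ᵤ-const′ c = trans (∑ᵤ-const c) (cong (ℕ._* c) #units)

    #units[x+1≢0] : ∑ᵤ[ x ] 𝟙[≢0] (x + + 1) ≡ 1 ℕ.+ k
    #units[x+1≢0] = solve-for 2 (1 ℕ.+ k) (begin
      ∑ᵤ[ x ] 𝟙[≢0] (x + + 1) ℕ.+ 2                         ≡⟨ sym (ℕₚ.+-assoc _ 1 1) ⟩
      ∑ᵤ[ x ] 𝟙[≢0] (x + + 1) ℕ.+ 1 ℕ.+ 1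
        ≡⟨ cong₂ (λ u v → u ℕ.+ 1 ℕ.+ v) (∑ᵤ-cong (λ x _ → cong 𝟙[≢0] (1*x+c x (+ 1)))) (sym 𝟙[≢0]1≡1) ⟩
      ∑ᵤ[ x ] 𝟙[≢0] (+ 1 * x + + 1) ℕ.+ 1 ℕ.+ 𝟙[≢0] (+ 1)   ≡⟨ nonvanishing-count₂ (+ 1) (+ 1) (inj₁ 1≢0-mod) ⟩
      p ℕ.+ δ₀ (+ 1)                                         ≡⟨ cong₂ ℕ._+_ p≡3+k (δ₀-nonzero 1≢0-mod) ⟩
      3 ℕ.+ k ℕ.+ 0                                          ∎) (ℕ-identity k)
      where
        open ≡-Reasoning
        ℕ-identity : ∀ k → 3 ℕ.+ k ℕ.+ 0 ≡ 1 ℕ.+ k ℕ.+ 2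
        ℕ-identity = ℕ-solve-∀

    #pairs[σ≢0] : ∑ᵤ[ x ] ∑ᵤ[ y ] 𝟙[≢0] (σ x y) ≡ k ℕ.* k ℕ.+ 3 ℕ.* k ℕ.+ 3
    #pairs[σ≢0] = solve-for ((2 ℕ.+ k) ℕ.* 2) (k ℕ.* k ℕ.+ 3 ℕ.* k ℕ.+ 3) (begin
      ∑ᵤ[ x ] ∑ᵤ[ y ] 𝟙[≢0] (+ 1 + x + y) ℕ.+ (2 ℕ.+ k) ℕ.* 2
        ≡⟨ cong (∑ᵤ[ x ] ∑ᵤ[ y ] 𝟙[≢0] (+ 1 + x + y) ℕ.+_) (sym (∑ᵤ-const′ 2)) ⟩
      ∑ᵤ[ x ] ∑ᵤ[ y ] 𝟙[≢0] (+ 1 + x + y) ℕ.+ ∑ᵤ[ _ ] 2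
        ≡⟨ ∑ᵤ-+-≡ (λ x → ∑ᵤ[ y ] 𝟙[≢0] (+ 1 + x + y)) (λ _ → 2) (λ _ → p) (λ x → δ x (- + 1)) (λ x _ → per-unit x) ⟩
      ∑ᵤ[ _ ] p ℕ.+ ∑ᵤ[ x ] δ x (- + 1)
        ≡⟨ cong₂ ℕ._+_ (∑ᵤ-const′ p) (trans (∑ᵤ-δ (- + 1)) (𝟙[≢0]-nonzero -1≢0)) ⟩
      (2 ℕ.+ k) ℕ.* p ℕ.+ 1                                     ≡⟨ cong (λ t → (2 ℕ.+ k) ℕ.* t ℕ.+ 1) p≡3+k ⟩
      (2 ℕ.+ k) ℕ.* (3 ℕ.+ k) ℕ.+ 1                             ∎) (ℕ-identity k)
      where
        open ≡-Reasoning
        ℕ-identity : ∀ k → (2 ℕ.+ k) ℕ.* (3 ℕ.+ k) ℕ.+ 1 ≡ k ℕ.* k ℕ.+ 3 ℕ.* k ℕ.+ 3 ℕ.+ (2 ℕ.+ k) ℕ.* 2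
        ℕ-identity = ℕ-solve-∀
        ℤ-identity : ∀ x y → + 1 + x + y ≡ + 1 * y + (+ 1 + x)
        ℤ-identity = solve-∀
        per-unit : ∀ x → ∑ᵤ[ y ] 𝟙[≢0] (+ 1 + x + y) ℕ.+ 2 ≡ p ℕ.+ δ x (- + 1)
        per-unit x = begin
          ∑ᵤ[ y ] 𝟙[≢0] (+ 1 + x + y) ℕ.+ 2                         ≡⟨ sym (ℕₚ.+-assoc _ 1 1) ⟩
          ∑ᵤ[ y ] 𝟙[≢0] (+ 1 + x + y) ℕ.+ 1 ℕ.+ 1
            ≡⟨ cong₂ (λ u v → u ℕ.+ 1 ℕ.+ v) (∑ᵤ-cong (λ y _ → cong 𝟙[≢0] (ℤ-identity x y))) (sym 𝟙[≢0]1≡1) ⟩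
          ∑ᵤ[ y ] 𝟙[≢0] (+ 1 * y + (+ 1 + x)) ℕ.+ 1 ℕ.+ 𝟙[≢0] (+ 1)
            ≡⟨ nonvanishing-count₂ (+ 1) (+ 1 + x) (inj₁ 1≢0-mod) ⟩
          p ℕ.+ δ₀ (+ 1 + x)
            ≡⟨ cong (p ℕ.+_) (trans (cong δ₀ (ℤₚ.+-comm (+ 1) x)) (δ₀-+ x (+ 1))) ⟩
          p ℕ.+ δ x (- + 1)                                          ∎

    #pairs[q≢0] : ∑ᵤ[ x ] ∑ᵤ[ y ] 𝟙[≢0] (q x y) ≡ k ℕ.* k ℕ.+ 3 ℕ.* k ℕ.+ 3
    #pairs[q≢0] = solve-for ((2 ℕ.+ k) ℕ.* 1 ℕ.+ (1 ℕ.+ k)) (k ℕ.* k ℕ.+ 3 ℕ.* k ℕ.+ 3) (begin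
      ∑ᵤ[ x ] ∑ᵤ[ y ] 𝟙[≢0] (x * y + x + y) ℕ.+ ((2 ℕ.+ k) ℕ.* 1 ℕ.+ (1 ℕ.+ k))
        ≡⟨ cong (∑ᵤ[ x ] ∑ᵤ[ y ] 𝟙[≢0] (x * y + x + y) ℕ.+_)
                (sym (trans (∑ᵤ-+ (λ _ → 1) (λ x → 𝟙[≢0] (x + + 1))) (cong₂ ℕ._+_ (∑ᵤ-const′ 1) #units[x+1≢0]))) ⟩
      ∑ᵤ[ x ] ∑ᵤ[ y ] 𝟙[≢0] (x * y + x + y) ℕ.+ ∑ᵤ[ x ] (1 ℕ.+ 𝟙[≢0] (x + + 1))
        ≡⟨ ∑ᵤ-+-≡ (λ x → ∑ᵤ[ y ] 𝟙[≢0] (x * y + x + y)) (λ x → 1 ℕ.+ 𝟙[≢0] (x + + 1)) (λ _ → p) (λ _ → 0) per-unit ⟩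
      ∑ᵤ[ _ ] p ℕ.+ ∑ᵤ[ _ ] 0
        ≡⟨ cong₂ ℕ._+_ (trans (∑ᵤ-const′ p) (cong ((2 ℕ.+ k) ℕ.*_) p≡3+k)) (∑ᵤ-const′ 0) ⟩
      (2 ℕ.+ k) ℕ.* (3 ℕ.+ k) ℕ.+ (2 ℕ.+ k) ℕ.* 0 ∎) (ℕ-identity k)
      where
        open ≡-Reasoning
        ℕ-identity : ∀ k → (2 ℕ.+ k) ℕ.* (3 ℕ.+ k) ℕ.+ (2 ℕ.+ k) ℕ.* 0 ≡ k ℕ.* k ℕ.+ 3 ℕ.* k ℕ.+ 3 ℕ.+ ((2 ℕ.+ k) ℕ.* 1 ℕ.+ (1 ℕ.+ k))
        ℕ-identity = ℕ-solve-∀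
        ℤ-identity : ∀ x y → x * y + x + y ≡ (x + + 1) * y + x
        ℤ-identity = solve-∀
        per-unit : ∀ x → ¬ x ≡ + 0 mod p → ∑ᵤ[ y ] 𝟙[≢0] (x * y + x + y) ℕ.+ (1 ℕ.+ 𝟙[≢0] (x + + 1)) ≡ p ℕ.+ 0
        per-unit x x≢0 = begin
          ∑ᵤ[ y ] 𝟙[≢0] (x * y + x + y) ℕ.+ (1 ℕ.+ 𝟙[≢0] (x + + 1))     ≡⟨ sym (ℕₚ.+-assoc _ 1 _) ⟩
          ∑ᵤ[ y ] 𝟙[≢0] (x * y + x + y) ℕ.+ 1 ℕ.+ 𝟙[≢0] (x + + 1)
            ≡⟨ cong (λ u → u ℕ.+ 1 ℕ.+ 𝟙[≢0] (x + + 1)) (∑ᵤ-cong (λ y _ → cong 𝟙[≢0] (ℤ-identity x y))) ⟩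
          ∑ᵤ[ y ] 𝟙[≢0] ((x + + 1) * y + x) ℕ.+ 1 ℕ.+ 𝟙[≢0] (x + + 1)   ≡⟨ nonvanishing-count₂ (x + + 1) x (inj₂ x≢0) ⟩
          p ℕ.+ δ₀ x                                                     ≡⟨ cong (p ℕ.+_) (δ₀-nonzero x≢0) ⟩
          p ℕ.+ 0                                                        ∎

    private
      Δ : ℤ → ℕ
      Δ x = ∑ᵤ[ y ] (𝟙[≢0] (y + x) ℕ.* 𝟙[≢0] (y + + 1))

      Δ+3 : ∀ x → ¬ x ≡ + 0 mod p → Δ x ℕ.+ 3 ≡ p ℕ.+ δ x (+ 1)
      Δ+3 x x≢0 = begin
        Δ x ℕ.+ 3                                                                    ≡⟨ ℕ-identity (Δ x) ⟩
        Δ x ℕ.+ 1 ℕ.+ 1 ℕ.+ 1                                                        ≡⟨ insert-units ⟩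
        ∑ᵤ[ y ] (𝟙[≢0] (y + x) ℕ.* 𝟙[≢0] (+ 1 * y + + 1)) ℕ.+ 𝟙[≢0] x ℕ.+ 𝟙[≢0] (+ 1) ℕ.+ 1
                                                                                     ≡⟨ nonvanishing-count₃ x (+ 1) (+ 1) 1≢0-mod ⟩
        p ℕ.+ δ₀ (+ 1 * - x + + 1)
          ≡⟨ cong (p ℕ.+_) (trans (cong δ₀ (ℤ-identity x)) (trans (δ₀-neg _) (δ₀-+ x (- + 1)))) ⟩
        p ℕ.+ δ x (+ 1)                                                              ∎
        where
          open ≡-Reasoning
          ℕ-identity : ∀ t → t ℕ.+ 3 ≡ t ℕ.+ 1 ℕ.+ 1 ℕ.+ 1
          ℕ-identity = ℕ-solve-∀
          ℤ-identity : ∀ x → + 1 * - x + + 1 ≡ - (x + - + 1)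
          ℤ-identity = solve-∀
          insert-units :
                  Δ x ℕ.+ 1 ℕ.+ 1 ℕ.+ 1 ≡ ∑ᵤ[ y ] (𝟙[≢0] (y + x) ℕ.* 𝟙[≢0] (+ 1 * y + + 1)) ℕ.+ 𝟙[≢0] x ℕ.+ 𝟙[≢0] (+ 1) ℕ.+ 1
          insert-units = cong₂ (λ u v → u ℕ.+ v ℕ.+ 1)
            (cong₂ ℕ._+_ (∑ᵤ-cong (λ y _ → cong (λ t → 𝟙[≢0] (y + x) ℕ.* 𝟙[≢0] t) (1*x+c y (+ 1))))
                         (sym (𝟙[≢0]-nonzero x≢0)))
            (sym 𝟙[≢0]1≡1)

    #pairs[x+1,y+x,y+1≢0] : ∑ᵤ[ x ] (𝟙[≢0] (x + + 1) ℕ.* Δ x) ≡ k ℕ.* k ℕ.+ k ℕ.+ 1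
    #pairs[x+1,y+x,y+1≢0] = solve-for (3 ℕ.* (1 ℕ.+ k)) (k ℕ.* k ℕ.+ k ℕ.+ 1) (begin
      ∑ᵤ[ x ] (𝟙[≢0] (x + + 1) ℕ.* Δ x) ℕ.+ 3 ℕ.* (1 ℕ.+ k)
        ≡⟨ cong (∑ᵤ[ x ] (𝟙[≢0] (x + + 1) ℕ.* Δ x) ℕ.+_) (sym (trans (∑ᵤ-*ˡ 3 (λ x → 𝟙[≢0] (x + + 1))) (cong (3 ℕ.*_) #units[x+1≢0]))) ⟩
      ∑ᵤ[ x ] (𝟙[≢0] (x + + 1) ℕ.* Δ x) ℕ.+ ∑ᵤ[ x ] (3 ℕ.* 𝟙[≢0] (x + + 1))
        ≡⟨ ∑ᵤ-+-≡ (λ x → 𝟙[≢0] (x + + 1) ℕ.* Δ x) (λ x → 3 ℕ.* 𝟙[≢0] (x + + 1))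
                  (λ x → p ℕ.* 𝟙[≢0] (x + + 1)) (λ x → 𝟙[≢0] (x + + 1) ℕ.* δ x (+ 1)) per-unit ⟩
      ∑ᵤ[ x ] (p ℕ.* 𝟙[≢0] (x + + 1)) ℕ.+ ∑ᵤ[ x ] (𝟙[≢0] (x + + 1) ℕ.* δ x (+ 1))
        ≡⟨ cong₂ ℕ._+_ (trans (∑ᵤ-*ˡ p (λ x → 𝟙[≢0] (x + + 1))) (cong₂ ℕ._*_ p≡3+k #units[x+1≢0])) only-x≡1 ⟩
      (3 ℕ.+ k) ℕ.* (1 ℕ.+ k) ℕ.+ 1 ∎) (ℕ-identity k)
      where
        open ≡-Reasoning
        ℕ-identity : ∀ k → (3 ℕ.+ k) ℕ.* (1 ℕ.+ k) ℕ.+ 1 ≡ k ℕ.* k ℕ.+ k ℕ.+ 1 ℕ.+ 3 ℕ.* (1 ℕ.+ k)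
        ℕ-identity = ℕ-solve-∀
        distribute : ∀ a Δ P d → a ℕ.* (Δ ℕ.+ 3) ≡ a ℕ.* (P ℕ.+ d) → a ℕ.* Δ ℕ.+ 3 ℕ.* a ≡ P ℕ.* a ℕ.+ a ℕ.* d
        distribute a Δ P d eq = trans (ℕ-identity₁ a Δ) (trans eq (ℕ-identity₂ a P d))
          where
            ℕ-identity₁ : ∀ a Δ → a ℕ.* Δ ℕ.+ 3 ℕ.* a ≡ a ℕ.* (Δ ℕ.+ 3)
            ℕ-identity₁ = ℕ-solve-∀
            ℕ-identity₂ : ∀ a P d → a ℕ.* (P ℕ.+ d) ≡ P ℕ.* a ℕ.+ a ℕ.* d
            ℕ-identity₂ = ℕ-solve-∀
        per-unit : ∀ x → ¬ x ≡ + 0 mod p →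
          𝟙[≢0] (x + + 1) ℕ.* Δ x ℕ.+ 3 ℕ.* 𝟙[≢0] (x + + 1) ≡ p ℕ.* 𝟙[≢0] (x + + 1) ℕ.+ 𝟙[≢0] (x + + 1) ℕ.* δ x (+ 1)
        per-unit x x≢0 = distribute (𝟙[≢0] (x + + 1)) (Δ x) p (δ x (+ 1)) (cong (𝟙[≢0] (x + + 1) ℕ.*_) (Δ+3 x x≢0))
        only-x≡1 : ∑ᵤ[ x ] (𝟙[≢0] (x + + 1) ℕ.* δ x (+ 1)) ≡ 1
        only-x≡1 = begin
          ∑ᵤ[ x ] (𝟙[≢0] (x + + 1) ℕ.* δ x (+ 1))
            ≡⟨ ∑ᵣ-cong (λ x → ℕ-rearrange (𝟙[≢0] x) (𝟙[≢0] (x + + 1)) (δ x (+ 1))) ⟩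
          ∑ᵣ[ x ] (δ x (+ 1) ℕ.* (𝟙[≢0] x ℕ.* 𝟙[≢0] (x + + 1)))
            ≡⟨ ∑ᵣ-δ-* (+ 1) (λ x → 𝟙[≢0] x ℕ.* 𝟙[≢0] (x + + 1)) periodic ⟩
          𝟙[≢0] (+ 1) ℕ.* 𝟙[≢0] (+ 2)                          ≡⟨ cong₂ ℕ._*_ 𝟙[≢0]1≡1 (𝟙[≢0]-nonzero 2≢0) ⟩
          1                                                     ∎
          where
            ℕ-rearrange : ∀ a b d → a ℕ.* (b ℕ.* d) ≡ d ℕ.* (a ℕ.* b)
            ℕ-rearrange = ℕ-solve-∀
            periodic : Periodic (λ x → 𝟙[≢0] x ℕ.* 𝟙[≢0] (x + + 1))
            periodic x≡ = cong₂ ℕ._*_ (𝟙[≢0]-periodic x≡) (𝟙[≢0]-periodic (+-cong-mod x≡ ≡-mod-refl))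

    #pairs[P≡0] : ∑ᵤ[ x ] ∑ᵤ[ y ] δ₀ (P x y) ≡ 3 ℕ.* k ℕ.+ 3
    #pairs[P≡0] = solve-for (k ℕ.* k ℕ.+ k ℕ.+ 1) (3 ℕ.* k ℕ.+ 3) (begin
      ∑ᵤ[ x ] ∑ᵤ[ y ] δ₀ (P x y) ℕ.+ (k ℕ.* k ℕ.+ k ℕ.+ 1)
        ≡⟨ cong (∑ᵤ[ x ] ∑ᵤ[ y ] δ₀ (P x y) ℕ.+_) (sym #pairs[x+1,y+x,y+1≢0]) ⟩
      ∑ᵤ[ x ] ∑ᵤ[ y ] δ₀ (P x y) ℕ.+ ∑ᵤ[ x ] (𝟙[≢0] (x + + 1) ℕ.* Δ x)
        ≡⟨ ∑ᵤ-+-≡ (λ x → ∑ᵤ[ y ] δ₀ (P x y)) (λ x → 𝟙[≢0] (x + + 1) ℕ.* Δ x)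
                  (λ _ → (2 ℕ.+ k) ℕ.* 1) (λ _ → (2 ℕ.+ k) ℕ.* 0) (λ x _ → per-unit x) ⟩
      ∑ᵤ[ _ ] ((2 ℕ.+ k) ℕ.* 1) ℕ.+ ∑ᵤ[ _ ] ((2 ℕ.+ k) ℕ.* 0)
        ≡⟨ cong₂ ℕ._+_ (∑ᵤ-const′ ((2 ℕ.+ k) ℕ.* 1)) (∑ᵤ-const′ ((2 ℕ.+ k) ℕ.* 0)) ⟩
      (2 ℕ.+ k) ℕ.* ((2 ℕ.+ k) ℕ.* 1) ℕ.+ (2 ℕ.+ k) ℕ.* ((2 ℕ.+ k) ℕ.* 0) ∎) (ℕ-identity k)
      where
        open ≡-Reasoning
        ℕ-identity : ∀ k → (2 ℕ.+ k) ℕ.* ((2 ℕ.+ k) ℕ.* 1) ℕ.+ (2 ℕ.+ k) ℕ.* ((2 ℕ.+ k) ℕ.* 0) ≡ 3 ℕ.* k ℕ.+ 3 ℕ.+ (k ℕ.* k ℕ.+ k ℕ.+ 1)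
        ℕ-identity = ℕ-solve-∀
        𝟙[≢0]-P : ∀ x y → 𝟙[≢0] (x + + 1) ℕ.* (𝟙[≢0] (y + x) ℕ.* 𝟙[≢0] (y + + 1)) ≡ 𝟙[≢0] (P x y)
        𝟙[≢0]-P x y = begin
          𝟙[≢0] (x + + 1) ℕ.* (𝟙[≢0] (y + x) ℕ.* 𝟙[≢0] (y + + 1))
            ≡⟨ cong (λ t → 𝟙[≢0] (x + + 1) ℕ.* (𝟙[≢0] t ℕ.* 𝟙[≢0] (y + + 1))) (ℤₚ.+-comm y x) ⟩
          𝟙[≢0] (x + + 1) ℕ.* (𝟙[≢0] (x + y) ℕ.* 𝟙[≢0] (y + + 1))
            ≡⟨ ℕ-rearrange (𝟙[≢0] (x + + 1)) (𝟙[≢0] (x + y)) (𝟙[≢0] (y + + 1)) ⟩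
          𝟙[≢0] (x + y) ℕ.* 𝟙[≢0] (x + + 1) ℕ.* 𝟙[≢0] (y + + 1)
            ≡⟨ sym (trans (𝟙[≢0]-* ((x + y) * (x + + 1)) (y + + 1)) (cong (ℕ._* 𝟙[≢0] (y + + 1)) (𝟙[≢0]-* (x + y) (x + + 1)))) ⟩
          𝟙[≢0] (P x y)                                               ∎
          where
            ℕ-rearrange : ∀ a b c → a ℕ.* (b ℕ.* c) ≡ b ℕ.* a ℕ.* c
            ℕ-rearrange = ℕ-solve-∀
        per-unit : ∀ x → ∑ᵤ[ y ] δ₀ (P x y) ℕ.+ 𝟙[≢0] (x + + 1) ℕ.* Δ x ≡ (2 ℕ.+ k) ℕ.* 1 ℕ.+ (2 ℕ.+ k) ℕ.* 0
        per-unit x = begin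
          ∑ᵤ[ y ] δ₀ (P x y) ℕ.+ 𝟙[≢0] (x + + 1) ℕ.* Δ x
            ≡⟨ cong (∑ᵤ[ y ] δ₀ (P x y) ℕ.+_) (sym (∑ᵤ-*ˡ (𝟙[≢0] (x + + 1)) (λ y → 𝟙[≢0] (y + x) ℕ.* 𝟙[≢0] (y + + 1)))) ⟩
          ∑ᵤ[ y ] δ₀ (P x y) ℕ.+ ∑ᵤ[ y ] (𝟙[≢0] (x + + 1) ℕ.* (𝟙[≢0] (y + x) ℕ.* 𝟙[≢0] (y + + 1)))
            ≡⟨ ∑ᵤ-+-≡ (λ y → δ₀ (P x y)) (λ y → 𝟙[≢0] (x + + 1) ℕ.* (𝟙[≢0] (y + x) ℕ.* 𝟙[≢0] (y + + 1))) (λ _ → 1) (λ _ → 0)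
                      (λ y _ → trans (cong (δ₀ (P x y) ℕ.+_) (𝟙[≢0]-P x y)) (trans (ℕₚ.+-comm (δ₀ (P x y)) _) (𝟙[≢0]+δ₀ (P x y)))) ⟩
          ∑ᵤ[ _ ] 1 ℕ.+ ∑ᵤ[ _ ] 0
            ≡⟨ cong₂ ℕ._+_ (∑ᵤ-const′ 1) (∑ᵤ-const′ 0) ⟩
          (2 ℕ.+ k) ℕ.* 1 ℕ.+ (2 ℕ.+ k) ℕ.* 0 ∎

    private
      ∑ᵤ-+₃ : ∀ (f g h : ℤ → ℕ) → ∑ᵤ[ x ] (f x ℕ.+ g x ℕ.+ h x) ≡ ∑ᵤ f ℕ.+ ∑ᵤ g ℕ.+ ∑ᵤ h
      ∑ᵤ-+₃ f g h = trans (∑ᵤ-+ (λ x → f x ℕ.+ g x) h) (cong (ℕ._+ ∑ᵤ h) (∑ᵤ-+ f g))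

      ∑ᵤ²-const : ∀ c → ∑ᵤ[ _ ] ∑ᵤ[ _ ] c ≡ (2 ℕ.+ k) ℕ.* ((2 ℕ.+ k) ℕ.* c)
      ∑ᵤ²-const c = trans (∑ᵤ-cong (λ _ _ → ∑ᵤ-const′ c)) (∑ᵤ-const′ ((2 ℕ.+ k) ℕ.* c))

      Z : ℤ → ℤ → ℕ
      Z x y = ∑ᵤ[ z ] (𝟙[≢0] (z + σ x y) ℕ.* 𝟙[≢0] (q x y * z + r x y))

      affineCount-by-units : affineCount ≡ ∑ᵤ[ x ] ∑ᵤ[ y ] Z x y
      affineCount-by-units = trans (∑ᵣ-cong (λ x → ∑ᵣ-cong (λ y → ∑ᵣ-cong (factorise x y))))
        (∑ᵣ-cong (λ x → trans (∑ᵣ-cong (λ y → trans (∑-*ˡ p (𝟙[≢0] x) (λ i → 𝟙[≢0] y ℕ.* (𝟙[≢0] (+ i) ℕ.* W x y (+ i))))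
                                                     (cong (𝟙[≢0] x ℕ.*_) (∑-*ˡ p (𝟙[≢0] y) (λ i → 𝟙[≢0] (+ i) ℕ.* W x y (+ i))))))
                              (∑-*ˡ p (𝟙[≢0] x) (λ j → 𝟙[≢0] (+ j) ℕ.* Z x (+ j)))))
        where
          W : ℤ → ℤ → ℤ → ℕ
          W x y z = 𝟙[≢0] (z + σ x y) ℕ.* 𝟙[≢0] (q x y * z + r x y)
          ℤ-identity₁ : ∀ x y z → + 1 + x + y + z ≡ z + (+ 1 + x + y)
          ℤ-identity₁ = solve-∀
          ℤ-identity₂ : ∀ x y z → + 1 * x * y * z * (+ 1 * x * y + + 1 * x * z + + 1 * y * z + x * y * z)
                                  ≡ x * y * z * ((x * y + x + y) * z + x * y)
          ℤ-identity₂ = solve-∀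
          ℕ-rearrange : ∀ s a b c e → s ℕ.* (a ℕ.* b ℕ.* c ℕ.* e) ≡ a ℕ.* (b ℕ.* (c ℕ.* (s ℕ.* e)))
          ℕ-rearrange = ℕ-solve-∀
          factorise : ∀ x y z → 𝟙[≢0] (+ 1 + x + y + z) ℕ.* 𝟙[≢0] (Q (+ 1) x y z) ≡ 𝟙[≢0] x ℕ.* (𝟙[≢0] y ℕ.* (𝟙[≢0] z ℕ.* W x y z))
          factorise x y z = begin
            𝟙[≢0] (+ 1 + x + y + z) ℕ.* 𝟙[≢0] (Q (+ 1) x y z)
              ≡⟨ cong₂ (λ s t → 𝟙[≢0] s ℕ.* 𝟙[≢0] t) (ℤ-identity₁ x y z) (ℤ-identity₂ x y z) ⟩
            𝟙[≢0] (z + σ x y) ℕ.* 𝟙[≢0] (x * y * z * (q x y * z + r x y))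
              ≡⟨ cong (𝟙[≢0] (z + σ x y) ℕ.*_) (trans (𝟙[≢0]-* (x * y * z) _) (cong (ℕ._* 𝟙[≢0] (q x y * z + r x y))
                                                    (trans (𝟙[≢0]-* (x * y) z) (cong (ℕ._* 𝟙[≢0] z) (𝟙[≢0]-* x y))))) ⟩
            𝟙[≢0] (z + σ x y) ℕ.* (𝟙[≢0] x ℕ.* 𝟙[≢0] y ℕ.* 𝟙[≢0] z ℕ.* 𝟙[≢0] (q x y * z + r x y))
              ≡⟨ ℕ-rearrange (𝟙[≢0] (z + σ x y)) (𝟙[≢0] x) (𝟙[≢0] y) (𝟙[≢0] z) (𝟙[≢0] (q x y * z + r x y)) ⟩
            𝟙[≢0] x ℕ.* (𝟙[≢0] y ℕ.* (𝟙[≢0] z ℕ.* W x y z)) ∎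
            where open ≡-Reasoning

      Z-per-pair : ∀ x y → ¬ x ≡ + 0 mod p → ¬ y ≡ + 0 mod p →
                   Z x y ℕ.+ (𝟙[≢0] (σ x y) ℕ.+ 𝟙[≢0] (q x y) ℕ.+ 1) ≡ p ℕ.+ δ₀ (P x y)
      Z-per-pair x y x≢0 y≢0 = begin
        Z x y ℕ.+ (𝟙[≢0] (σ x y) ℕ.+ 𝟙[≢0] (q x y) ℕ.+ 1)  ≡⟨ ℕ-reassoc (Z x y) (𝟙[≢0] (σ x y)) (𝟙[≢0] (q x y)) ⟩
        Z x y ℕ.+ 𝟙[≢0] (σ x y) ℕ.+ 𝟙[≢0] (q x y) ℕ.+ 1
          ≡⟨ nonvanishing-count₃ (σ x y) (q x y) (r x y) (≢0-mod-* p-prime x≢0 y≢0) ⟩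
        p ℕ.+ δ₀ (q x y * - σ x y + r x y)
          ≡⟨ cong (p ℕ.+_) (trans (cong δ₀ (ℤ-identity x y)) (δ₀-neg (P x y))) ⟩
        p ℕ.+ δ₀ (P x y)                                  ∎
        where
          open ≡-Reasoning
          ℕ-reassoc : ∀ a b c → a ℕ.+ (b ℕ.+ c ℕ.+ 1) ≡ a ℕ.+ b ℕ.+ c ℕ.+ 1
          ℕ-reassoc = ℕ-solve-∀
          ℤ-identity : ∀ x y → (x * y + x + y) * - (+ 1 + x + y) + x * y ≡ - ((x + y) * (x + + 1) * (y + + 1))
          ℤ-identity = solve-∀

    -- 1 + x + y + z = z + σ x y and Q 1 x y z = xyz · (q x y · z + r x y), so for units x, y the count over z
    -- is nonvanishing-count₃, where q (-σ) + r = -P.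
    affineCount≡ : affineCount ≡ k ℕ.* k ℕ.* k ℕ.+ 4 ℕ.* (k ℕ.* k) ℕ.+ 9 ℕ.* k ℕ.+ 5
    affineCount≡ = trans affineCount-by-units (solve-for (A ℕ.+ A ℕ.+ (2 ℕ.+ k) ℕ.* ((2 ℕ.+ k) ℕ.* 1)) _ (begin
      ∑ᵤ[ x ] ∑ᵤ[ y ] Z x y ℕ.+ (A ℕ.+ A ℕ.+ (2 ℕ.+ k) ℕ.* ((2 ℕ.+ k) ℕ.* 1))
        ≡⟨ cong (∑ᵤ[ x ] ∑ᵤ[ y ] Z x y ℕ.+_) (sym split) ⟩
      ∑ᵤ[ x ] ∑ᵤ[ y ] Z x y ℕ.+ ∑ᵤ[ x ] ∑ᵤ[ y ] (𝟙[≢0] (σ x y) ℕ.+ 𝟙[≢0] (q x y) ℕ.+ 1)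
        ≡⟨ ∑ᵤ-+-≡ (λ x → ∑ᵤ[ y ] Z x y) (λ x → ∑ᵤ[ y ] (𝟙[≢0] (σ x y) ℕ.+ 𝟙[≢0] (q x y) ℕ.+ 1))
                  (λ x → ∑ᵤ[ _ ] p) (λ x → ∑ᵤ[ y ] δ₀ (P x y))
                  (λ x x≢0 → ∑ᵤ-+-≡ (Z x) (λ y → 𝟙[≢0] (σ x y) ℕ.+ 𝟙[≢0] (q x y) ℕ.+ 1) (λ _ → p) (λ y → δ₀ (P x y))
                                    (λ y y≢0 → Z-per-pair x y x≢0 y≢0)) ⟩
      ∑ᵤ[ _ ] ∑ᵤ[ _ ] p ℕ.+ ∑ᵤ[ x ] ∑ᵤ[ y ] δ₀ (P x y)
        ≡⟨ cong₂ ℕ._+_ (trans (∑ᵤ²-const p) (cong (λ t → (2 ℕ.+ k) ℕ.* ((2 ℕ.+ k) ℕ.* t)) p≡3+k)) #pairs[P≡0] ⟩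
      (2 ℕ.+ k) ℕ.* ((2 ℕ.+ k) ℕ.* (3 ℕ.+ k)) ℕ.+ (3 ℕ.* k ℕ.+ 3) ∎) (ℕ-identity k))
      where
        open ≡-Reasoning
        A : ℕ
        A = k ℕ.* k ℕ.+ 3 ℕ.* k ℕ.+ 3
        split : ∑ᵤ[ x ] ∑ᵤ[ y ] (𝟙[≢0] (σ x y) ℕ.+ 𝟙[≢0] (q x y) ℕ.+ 1) ≡ A ℕ.+ A ℕ.+ (2 ℕ.+ k) ℕ.* ((2 ℕ.+ k) ℕ.* 1)
        split = trans (∑ᵤ-cong (λ x _ → ∑ᵤ-+₃ (λ y → 𝟙[≢0] (σ x y)) (λ y → 𝟙[≢0] (q x y)) (λ _ → 1)))
                      (trans (∑ᵤ-+₃ (λ x → ∑ᵤ[ y ] 𝟙[≢0] (σ x y)) (λ x → ∑ᵤ[ y ] 𝟙[≢0] (q x y)) (λ _ → ∑ᵤ[ _ ] 1))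
                             (cong₂ ℕ._+_ (cong₂ ℕ._+_ #pairs[σ≢0] #pairs[q≢0]) (∑ᵤ²-const 1)))
        ℕ-identity : ∀ k → (2 ℕ.+ k) ℕ.* ((2 ℕ.+ k) ℕ.* (3 ℕ.+ k)) ℕ.+ (3 ℕ.* k ℕ.+ 3)
                           ≡ k ℕ.* k ℕ.* k ℕ.+ 4 ℕ.* (k ℕ.* k) ℕ.+ 9 ℕ.* k ℕ.+ 5
                             ℕ.+ ((k ℕ.* k ℕ.+ 3 ℕ.* k ℕ.+ 3) ℕ.+ (k ℕ.* k ℕ.+ 3 ℕ.* k ℕ.+ 3) ℕ.+ (2 ℕ.+ k) ℕ.* ((2 ℕ.+ k) ℕ.* 1))
        ℕ-identity = ℕ-solve-∀

module LocalCount {p : ℕ} (p-prime : Prime p) (M : ℤ) where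

  open import Data.Nat as ℕ using (ℕ; zero; suc)
  import Data.Nat.Properties as ℕₚ
  open import Data.Integer using (ℤ; +_; _+_; _*_; _-_; _^_)
  import Data.Integer.Properties as ℤₚ
  open import Data.Integer.Tactic.RingSolver using (solve-∀)
  open import Relation.Binary.PropositionalEquality
  open import Relation.Nullary using (yes; no; ¬_)
  open ResidueSums p-prime
  open AffineCount p-prime using (affineCount)

  localCount : ℕ
  localCount = ∑ᵣ[ a ] ∑ᵣ[ b ] ∑ᵣ[ c ] 𝟙[≢0] (Qᴹ M a b c)

  localCount-affine : ∀ {u} → ¬ u ≡ + 0 mod p → ∀ r s t →
    ∑ᵣ[ a ] ∑ᵣ[ b ] ∑ᵣ[ c ] 𝟙[≢0] (Qᴹ M (r + u * a) (s + u * b) (t + u * c)) ≡ localCount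
  localCount-affine {u} u≢0 r s t = begin
    ∑ᵣ[ a ] ∑ᵣ[ b ] ∑ᵣ[ c ] 𝟙[≢0] (Qᴹ M (r + u * a) (s + u * b) (t + u * c))
      ≡⟨ ∑ᵣ-cong (λ a → ∑ᵣ-cong (λ b → ∑ᵣ-affine u≢0 t (λ c → 𝟙[≢0] (Qᴹ M (r + u * a) (s + u * b) c))
                                                   (periodic-in-c (r + u * a) (s + u * b)))) ⟩
    ∑ᵣ[ a ] ∑ᵣ[ b ] ∑ᵣ[ c ] 𝟙[≢0] (Qᴹ M (r + u * a) (s + u * b) c)
      ≡⟨ ∑ᵣ-cong (λ a → ∑ᵣ-affine u≢0 s (λ b → ∑ᵣ[ c ] 𝟙[≢0] (Qᴹ M (r + u * a) b c))
                                    (∑ᵣ-periodic (λ b c → 𝟙[≢0] (Qᴹ M (r + u * a) b c)) (periodic-in-b (r + u * a)))) ⟩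
    ∑ᵣ[ a ] ∑ᵣ[ b ] ∑ᵣ[ c ] 𝟙[≢0] (Qᴹ M (r + u * a) b c)
      ≡⟨ ∑ᵣ-affine u≢0 r (λ a → ∑ᵣ[ b ] ∑ᵣ[ c ] 𝟙[≢0] (Qᴹ M a b c))
                     (∑ᵣ-periodic (λ a b → ∑ᵣ[ c ] 𝟙[≢0] (Qᴹ M a b c)) (λ b → ∑ᵣ-periodic (λ a c → 𝟙[≢0] (Qᴹ M a b c)) (periodic-in-a b))) ⟩
    localCount ∎
    where
      open ≡-Reasoning
      periodic-in-a : ∀ b c → Periodic (λ a → 𝟙[≢0] (Qᴹ M a b c))
      periodic-in-a b c a≡ = 𝟙[≢0]-periodic (Qᴹ-cong-mod a≡ (≡-mod-refl {x = b}) (≡-mod-refl {x = c}) (≡-mod-refl {x = M}))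
      periodic-in-b : ∀ a c → Periodic (λ b → 𝟙[≢0] (Qᴹ M a b c))
      periodic-in-b a c b≡ = 𝟙[≢0]-periodic (Qᴹ-cong-mod (≡-mod-refl {x = a}) b≡ (≡-mod-refl {x = c}) (≡-mod-refl {x = M}))
      periodic-in-c : ∀ a b → Periodic (λ c → 𝟙[≢0] (Qᴹ M a b c))
      periodic-in-c a b c≡ = 𝟙[≢0]-periodic (Qᴹ-cong-mod (≡-mod-refl {x = a}) (≡-mod-refl {x = b}) c≡ (≡-mod-refl {x = M}))

  private
    hyperplane : ℤ → ℤ → ℤ → ℤ → ℕ
    hyperplane a b c d = δ (a + b + c + d) M ℕ.* 𝟙[≢0] (Q a b c d)

  Qᴹ-fibre : ∀ a b c → 𝟙[≢0] (Qᴹ M a b c) ≡ ∑ᵣ[ d ] hyperplane a b c d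
  Qᴹ-fibre a b c = sym (trans
    (∑ᵣ-cong {g = λ d → δ d (M - a - b - c) ℕ.* 𝟙[≢0] (Q a b c d)} (λ d → cong (ℕ._* 𝟙[≢0] (Q a b c d)) (δ-⇔ (solve-d d) (unsolve-d d))))
    (∑ᵣ-δ-* (M - a - b - c) (λ d → 𝟙[≢0] (Q a b c d))
            (λ d≡d′ → 𝟙[≢0]-periodic (Q-cong-mod (≡-mod-refl {x = a}) (≡-mod-refl {x = b}) (≡-mod-refl {x = c}) d≡d′))))
    where
      ℤ-identity₁ : ∀ a b c d → d ≡ a + b + c + d - a - b - c
      ℤ-identity₁ = solve-∀
      ℤ-identity₂ : ∀ M a b c → a + b + c + (M - a - b - c) ≡ M
      ℤ-identity₂ = solve-∀
      solve-d : ∀ d → a + b + c + d ≡ M mod p → d ≡ M - a - b - c mod p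
      solve-d d sum≡M = ≡-mod-trans (≡⇒≡-mod (ℤ-identity₁ a b c d)) (lhs≡rhs (⟦ sum≡M ⟧ ⊝ same a ⊝ same b ⊝ same c))
      unsolve-d : ∀ d → d ≡ M - a - b - c mod p → a + b + c + d ≡ M mod p
      unsolve-d d d≡ = ≡-mod-trans (lhs≡rhs (same a ⊕ same b ⊕ same c ⊕ ⟦ d≡ ⟧)) (≡⇒≡-mod (ℤ-identity₂ M a b c))

  private
    hyperplane-periodic : ∀ {a a′ b b′ c c′ d d′} → a ≡ a′ mod p → b ≡ b′ mod p → c ≡ c′ mod p → d ≡ d′ mod p →
                          hyperplane a b c d ≡ hyperplane a′ b′ c′ d′
    hyperplane-periodic a≡ b≡ c≡ d≡ =
      cong₂ ℕ._*_ (δ-periodic M (lhs≡rhs (⟦ a≡ ⟧ ⊕ ⟦ b≡ ⟧ ⊕ ⟦ c≡ ⟧ ⊕ ⟦ d≡ ⟧))) (𝟙[≢0]-periodic (Q-cong-mod a≡ b≡ c≡ d≡))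

    periodic-in-b : ∀ a c d → Periodic (λ b → hyperplane a b c d)
    periodic-in-b a c d {b} {b′} b≡ = hyperplane-periodic {a} {a} {b} {b′} {c} {c} {d} {d} ≡-mod-refl b≡ ≡-mod-refl ≡-mod-refl

    periodic-in-c : ∀ a b d → Periodic (λ c → hyperplane a b c d)
    periodic-in-c a b d {c} {c′} c≡ = hyperplane-periodic {a} {a} {b} {b} {c} {c′} {d} {d} ≡-mod-refl ≡-mod-refl c≡ ≡-mod-refl

    periodic-in-d : ∀ a b c → Periodic (hyperplane a b c)
    periodic-in-d a b c {d} {d′} = hyperplane-periodic {a} {a} {b} {b} {c} {c} {d} {d′} ≡-mod-refl ≡-mod-refl ≡-mod-refl

    𝟙[≢0]-^-* : ∀ {a} → ¬ a ≡ + 0 mod p → ∀ n x → 𝟙[≢0] (a ^ n * x) ≡ 𝟙[≢0] x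
    𝟙[≢0]-^-* a≢0 zero    x = cong 𝟙[≢0] (ℤₚ.*-identityˡ x)
    𝟙[≢0]-^-* {a} a≢0 (suc n) x = begin
      𝟙[≢0] (a * a ^ n * x)     ≡⟨ cong 𝟙[≢0] (ℤₚ.*-assoc a (a ^ n) x) ⟩
      𝟙[≢0] (a * (a ^ n * x))   ≡⟨ 𝟙[≢0]-*-unit a≢0 (a ^ n * x) ⟩
      𝟙[≢0] (a ^ n * x)         ≡⟨ 𝟙[≢0]-^-* a≢0 n x ⟩
      𝟙[≢0] x                   ∎
      where open ≡-Reasoning

    homogeneity : ∀ a b c d → hyperplane a (a * b) (a * c) (a * d) ≡ δ (a * (+ 1 + b + c + d)) M ℕ.* 𝟙[≢0] (a ^ 7 * Q (+ 1) b c d)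
    homogeneity a b c d = cong₂ (λ s t → δ s M ℕ.* 𝟙[≢0] t) (ℤ-identity₁ a b c d) (ℤ-identity₂ a b c d)
      where
        ℤ-identity₁ : ∀ a b c d → a + a * b + a * c + a * d ≡ a * (+ 1 + b + c + d)
        ℤ-identity₁ = solve-∀
        ℤ-identity₂ : ∀ a b c d →
          a * (a * b) * (a * c) * (a * d) * (a * (a * b) * (a * c) + a * (a * b) * (a * d) + a * (a * c) * (a * d) + a * b * (a * c) * (a * d))
            ≡ a * (a * (a * (a * (a * (a * (a * + 1)))))) * (+ 1 * b * c * d * (+ 1 * b * c + + 1 * b * d + + 1 * c * d + b * c * d))
        ℤ-identity₂ = solve-∀

    slice : ∀ a → ∑ᵣ[ b ] ∑ᵣ[ c ] ∑ᵣ[ d ] hyperplane a b c d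
                ≡ 𝟙[≢0] a ℕ.* ∑ᵣ[ b ] ∑ᵣ[ c ] ∑ᵣ[ d ] (δ (a * (+ 1 + b + c + d)) M ℕ.* 𝟙[≢0] (Q (+ 1) b c d))
    slice a with a ≡? + 0 mod p
    ... | yes a≡0 = trans (∑ᵣ-cong (λ b → trans (∑ᵣ-cong (λ c → trans (∑ᵣ-cong (λ d → Q-vanishes b c d)) (∑-0 p))) (∑-0 p))) (∑-0 p)
      where
        ℤ-identity : ∀ a b c d → a * b * c * d * (a * b * c + a * b * d + a * c * d + b * c * d)
                                 ≡ a * (b * c * d * (a * b * c + a * b * d + a * c * d + b * c * d))
        ℤ-identity = solve-∀
        Q-vanishes : ∀ b c d → hyperplane a b c d ≡ 0
        Q-vanishes b c d =
          trans (cong (δ (a + b + c + d) M ℕ.*_) (𝟙[≢0]-zero {Q a b c d} (≡-mod-trans (≡⇒≡-mod (ℤ-identity a b c d)) (*-zeroˡ-mod _ a≡0))))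
                                 (ℕₚ.*-zeroʳ (δ (a + b + c + d) M))
    ... | no a≢0 = begin
      ∑ᵣ[ b ] ∑ᵣ[ c ] ∑ᵣ[ d ] hyperplane a b c d
        ≡⟨ sym (∑ᵣ-scale a≢0 (λ b → ∑ᵣ[ c ] ∑ᵣ[ d ] hyperplane a b c d)
                            (∑ᵣ-periodic (λ b c → ∑ᵣ[ d ] hyperplane a b c d)
                                         (λ c → ∑ᵣ-periodic (λ b d → hyperplane a b c d) (λ d → periodic-in-b a c d)))) ⟩
      ∑ᵣ[ b ] ∑ᵣ[ c ] ∑ᵣ[ d ] hyperplane a (a * b) c d
        ≡⟨ ∑ᵣ-cong (λ b → sym (∑ᵣ-scale a≢0 (λ c → ∑ᵣ[ d ] hyperplane a (a * b) c d)
                                           (∑ᵣ-periodic (λ c d → hyperplane a (a * b) c d) (λ d → periodic-in-c a (a * b) d)))) ⟩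
      ∑ᵣ[ b ] ∑ᵣ[ c ] ∑ᵣ[ d ] hyperplane a (a * b) (a * c) d
        ≡⟨ ∑ᵣ-cong (λ b → ∑ᵣ-cong (λ c → sym (∑ᵣ-scale a≢0 (hyperplane a (a * b) (a * c)) (periodic-in-d a (a * b) (a * c))))) ⟩
      ∑ᵣ[ b ] ∑ᵣ[ c ] ∑ᵣ[ d ] hyperplane a (a * b) (a * c) (a * d)
        ≡⟨ ∑ᵣ-cong (λ b → ∑ᵣ-cong (λ c → ∑ᵣ-cong (λ d → trans (homogeneity a b c d)
                                                            (cong (δ (a * (+ 1 + b + c + d)) M ℕ.*_) (𝟙[≢0]-^-* a≢0 7 (Q (+ 1) b c d)))))) ⟩
      ∑ᵣ[ b ] ∑ᵣ[ c ] ∑ᵣ[ d ] (δ (a * (+ 1 + b + c + d)) M ℕ.* 𝟙[≢0] (Q (+ 1) b c d))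
        ≡⟨ sym (ℕₚ.*-identityˡ _) ⟩
      1 ℕ.* ∑ᵣ[ b ] ∑ᵣ[ c ] ∑ᵣ[ d ] (δ (a * (+ 1 + b + c + d)) M ℕ.* 𝟙[≢0] (Q (+ 1) b c d)) ∎
      where open ≡-Reasoning

  ∑ᵤ-δ-scaled : ¬ M ≡ + 0 mod p → ∀ s → ∑ᵤ[ a ] δ (a * s) M ≡ 𝟙[≢0] s
  ∑ᵤ-δ-scaled M≢0 s with s ≡? + 0 mod p
  ... | yes s≡0 = trans (∑ᵣ-cong (λ a → trans (cong (𝟙[≢0] a ℕ.*_) (as≢M a)) (ℕₚ.*-zeroʳ (𝟙[≢0] a)))) (∑-0 p)
    where
      as≢M : ∀ a → δ (a * s) M ≡ 0
      as≢M a = 𝟙-no (a * s ≡? M mod p) (λ as≡M → M≢0 (≡-mod-trans (≡-mod-sym as≡M) (*-zeroʳ-mod a s≡0)))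
  ... | no s≢0 = begin
    ∑ᵤ[ a ] δ (a * s) M    ≡⟨ ∑ᵣ-cong unit-or-miss ⟩
    ∑ᵣ[ a ] δ (s * a) M    ≡⟨ ∑ᵣ-scale s≢0 (λ x → δ x M) (δ-periodic M) ⟩
    ∑ᵣ[ a ] δ a M          ≡⟨ ∑ᵣ-δ M ⟩
    1                      ∎
    where
      open ≡-Reasoning
      unit-or-miss : ∀ a → 𝟙[≢0] a ℕ.* δ (a * s) M ≡ δ (s * a) M
      unit-or-miss a with a ≡? + 0 mod p
      ... | yes a≡0 = sym (𝟙-no (s * a ≡? M mod p) (λ sa≡M → M≢0 (≡-mod-trans (≡-mod-sym sa≡M) (*-zeroʳ-mod s a≡0))))
      ... | no _    = trans (ℕₚ.+-identityʳ _) (cong (λ t → δ t M) (ℤₚ.*-comm a s))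

  -- After the substitution (b, c, d) ↦ (a b, a c, a d) for a unit a, summing over a leaves, for each (b, c, d)
  -- with 1 + b + c + d ≢ 0, exactly one unit a with a (1 + b + c + d) ≡ M, since M ≢ 0.
  localCount≡affineCount : ¬ M ≡ + 0 mod p → localCount ≡ affineCount
  localCount≡affineCount M≢0 = begin
    localCount
      ≡⟨ ∑ᵣ-cong (λ a → ∑ᵣ-cong (λ b → ∑ᵣ-cong (Qᴹ-fibre a b))) ⟩
    ∑ᵣ[ a ] ∑ᵣ[ b ] ∑ᵣ[ c ] ∑ᵣ[ d ] hyperplane a b c d
      ≡⟨ ∑ᵣ-cong slice ⟩
    ∑ᵣ[ a ] (𝟙[≢0] a ℕ.* ∑ᵣ[ b ] ∑ᵣ[ c ] ∑ᵣ[ d ] (δ (a * s b c d) M ℕ.* G b c d))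
      ≡⟨ ∑ᵣ-cong (λ a → *-distribˡ-∑ᵣ³ (𝟙[≢0] a) (λ b c d → δ (a * s b c d) M ℕ.* G b c d)) ⟩
    ∑ᵣ[ a ] ∑ᵣ[ b ] ∑ᵣ[ c ] ∑ᵣ[ d ] (𝟙[≢0] a ℕ.* (δ (a * s b c d) M ℕ.* G b c d))
      ≡⟨ a-innermost (λ a b c d → 𝟙[≢0] a ℕ.* (δ (a * s b c d) M ℕ.* G b c d)) ⟩
    ∑ᵣ[ b ] ∑ᵣ[ c ] ∑ᵣ[ d ] ∑ᵣ[ a ] (𝟙[≢0] a ℕ.* (δ (a * s b c d) M ℕ.* G b c d))
      ≡⟨ ∑ᵣ-cong (λ b → ∑ᵣ-cong (λ c → ∑ᵣ-cong (λ d → sum-over-a b c d))) ⟩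
    affineCount ∎
    where
      open ≡-Reasoning
      s : ℤ → ℤ → ℤ → ℤ
      s b c d = + 1 + b + c + d
      G : ℤ → ℤ → ℤ → ℕ
      G b c d = 𝟙[≢0] (Q (+ 1) b c d)
      *-distribˡ-∑ᵣ³ : ∀ k (f : ℤ → ℤ → ℤ → ℕ) → k ℕ.* ∑ᵣ[ b ] ∑ᵣ[ c ] ∑ᵣ[ d ] f b c d ≡ ∑ᵣ[ b ] ∑ᵣ[ c ] ∑ᵣ[ d ] (k ℕ.* f b c d)
      *-distribˡ-∑ᵣ³ k f = sym (trans (∑ᵣ-cong (λ b → trans (∑ᵣ-cong (λ c → ∑-*ˡ p k (λ i → f b c (+ i))))
                                                          (∑-*ˡ p k (λ i → ∑ᵣ[ d ] f b (+ i) d))))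
                                     (∑-*ˡ p k (λ i → ∑ᵣ[ c ] ∑ᵣ[ d ] f (+ i) c d)))
      a-innermost : ∀ (f : ℤ → ℤ → ℤ → ℤ → ℕ) →
        ∑ᵣ[ a ] ∑ᵣ[ b ] ∑ᵣ[ c ] ∑ᵣ[ d ] f a b c d ≡ ∑ᵣ[ b ] ∑ᵣ[ c ] ∑ᵣ[ d ] ∑ᵣ[ a ] f a b c d
      a-innermost f =
        trans (∑-comm p p (λ i j → ∑ᵣ[ c ] ∑ᵣ[ d ] f (+ i) (+ j) c d))
              (∑ᵣ-cong (λ b → trans (∑-comm p p (λ i j → ∑ᵣ[ d ] f (+ i) b (+ j) d))
                                    (∑ᵣ-cong (λ c → ∑-comm p p (λ i j → f (+ i) b c (+ j))))))
      sum-over-a : ∀ b c d → ∑ᵣ[ a ] (𝟙[≢0] a ℕ.* (δ (a * s b c d) M ℕ.* G b c d)) ≡ 𝟙[≢0] (s b c d) ℕ.* G b c d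
      sum-over-a b c d =
        trans (∑ᵣ-cong (λ a → sym (ℕₚ.*-assoc (𝟙[≢0] a) (δ (a * s b c d) M) (G b c d))))
              (trans (∑-*ʳ p (G b c d) (λ i → 𝟙[≢0] (+ i) ℕ.* δ (+ i * s b c d) M))
                     (cong (ℕ._* G b c d) (∑ᵤ-δ-scaled M≢0 (s b c d))))

module Admissibility where

  open import Data.Nat as ℕ using (ℕ; suc; NonZero; s≤s)
  import Data.Nat.Properties as ℕₚ
  open import Data.Nat.Divisibility using (_∣_; _∣?_; ∣⇒≤; ∣n⇒∣m*n; m∣m*n)
  open import Data.Nat.Primality using (Prime; prime?; prime⇒nonZero; euclidsLemma; prime⇒irreducible; ¬prime[1])
  open import Data.Integer using (ℤ; +_)
  open import Data.List using (upTo)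
  open import Data.List.Relation.Unary.All as All using (All)
  open import Data.List.Membership.Propositional using (_∈_)
  open import Data.List.Membership.Propositional.Properties using (∈-filter⁺; ∈-filter⁻; ∈-upTo⁺)
  open import Data.Product using (_×_; _,_; proj₂)
  open import Data.Sum using (inj₁; inj₂)
  open import Data.Empty using (⊥-elim)
  open import Relation.Binary.PropositionalEquality
  open import Relation.Nullary using (Dec; ¬_)
  open import Relation.Nullary.Decidable using (_×-dec_; ¬?; map′)
  open import Defs using (primeDivisors)

  ∈-primeDivisors⁻ : ∀ {n q} → q ∈ primeDivisors n → Prime q × q ∣ n
  ∈-primeDivisors⁻ {n} q∈ = proj₂ (∈-filter⁻ (λ p → prime? p ×-dec (p ∣? n)) {xs = upTo (suc n)} q∈)

  ∈-primeDivisors⁺ : ∀ {n q} .{{_ : NonZero n}} → Prime q → q ∣ n → q ∈ primeDivisors n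
  ∈-primeDivisors⁺ {n} q-prime q∣n = ∈-filter⁺ (λ p → prime? p ×-dec (p ∣? n)) (∈-upTo⁺ (s≤s (∣⇒≤ q∣n))) (q-prime , q∣n)

  prime∣prime⇒≡ : ∀ {p q} → Prime p → Prime q → q ∣ p → q ≡ p
  prime∣prime⇒≡ p-prime q-prime q∣p with prime⇒irreducible p-prime q∣p
  ... | inj₁ refl = ⊥-elim (¬prime[1] q-prime)
  ... | inj₂ q≡p  = q≡p

  -- A record rather than a bare All, so that M, n, a, b, c can be inferred from an admissibility proof.
  record Admissible (M : ℤ) (n : ℕ) (a b c : ℤ) : Set where
    constructor admissible
    field nonvanishing : All (λ q → ¬ Qᴹ M a b c ≡ + 0 mod q) (primeDivisors n)

  admissible? : ∀ M n a b c → Dec (Admissible M n a b c)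
  admissible? M n a b c =
    map′ admissible Admissible.nonvanishing (All.all? (λ q → ¬? (Qᴹ M a b c ≡? + 0 mod q)) (primeDivisors n))

  module _ {M : ℤ} {n : ℕ} {a b c : ℤ} where

    admissible⇒ : .{{_ : NonZero n}} → Admissible M n a b c → ∀ {q} → Prime q → q ∣ n → ¬ Qᴹ M a b c ≡ + 0 mod q
    admissible⇒ (admissible Q≢0) q-prime q∣n = All.lookup Q≢0 (∈-primeDivisors⁺ q-prime q∣n)

    admissible⇐ : (∀ {q} → Prime q → q ∣ n → ¬ Qᴹ M a b c ≡ + 0 mod q) → Admissible M n a b c
    admissible⇐ Q≢0 = admissible (All.tabulate (λ q∈ → let q-prime , q∣n = ∈-primeDivisors⁻ q∈ in Q≢0 q-prime q∣n))

  admissible-periodic : ∀ {M n a a′ b b′ c c′} .{{_ : NonZero n}} → a ≡ a′ mod n → b ≡ b′ mod n → c ≡ c′ mod n →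
                        Admissible M n a b c → Admissible M n a′ b′ c′
  admissible-periodic {M} a≡ b≡ c≡ adm = admissible⇐ λ q-prime q∣n Q′≡0 →
    admissible⇒ adm q-prime q∣n (≡-mod-trans (Qᴹ-cong-mod (≡-mod-∣ q∣n a≡) (≡-mod-∣ q∣n b≡) (≡-mod-∣ q∣n c≡) (≡-mod-refl {x = M})) Q′≡0)

  module _ {M : ℤ} {p N : ℕ} (p-prime : Prime p) .{{_ : NonZero N}} {a b c : ℤ} where

    private
      instance
        p≢0 : NonZero p
        p≢0 = prime⇒nonZero p-prime
        pN≢0 : NonZero (p ℕ.* N)
        pN≢0 = ℕₚ.m*n≢0 p N

    admissible-*⁻ : Admissible M (p ℕ.* N) a b c → Admissible M N a b c × ¬ Qᴹ M a b c ≡ + 0 mod p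
    admissible-*⁻ adm = admissible⇐ (λ q-prime q∣N → admissible⇒ adm q-prime (∣n⇒∣m*n p q∣N))
                      , admissible⇒ adm p-prime (m∣m*n N)

    admissible-*⁺ : Admissible M N a b c → ¬ Qᴹ M a b c ≡ + 0 mod p → Admissible M (p ℕ.* N) a b c
    admissible-*⁺ adm Q≢0 = admissible⇐ by-prime
      where
        by-prime : ∀ {q} → Prime q → q ∣ p ℕ.* N → ¬ Qᴹ M a b c ≡ + 0 mod q
        by-prime {q} q-prime q∣pN with euclidsLemma p N q-prime q∣pN
        ... | inj₁ q∣p = subst (λ t → ¬ Qᴹ M a b c ≡ + 0 mod t) (sym (prime∣prime⇒≡ p-prime q-prime q∣p)) Q≢0
        ... | inj₂ q∣N = admissible⇒ adm q-prime q∣N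

  count : ℤ → ℕ → ℕ
  count M n = ∑³ n (λ a b c → 𝟙 (admissible? M n (+ a) (+ b) (+ c)))

open Admissibility

module Multiplicativity where

  open import Data.Nat as ℕ using (ℕ; NonZero)
  import Data.Nat.Properties as ℕₚ
  open import Data.Nat.Divisibility using (_∣_)
  open import Data.Nat.Primality using (Prime; prime⇒nonZero)
  open import Data.Integer using (ℤ; +_; _+_; _*_)
  import Data.Integer.Properties as ℤₚ
  open import Data.Integer.Tactic.RingSolver using (solve-∀)
  open import Data.Product using (_,_; proj₁)
  open import Relation.Binary.PropositionalEquality
  open import Relation.Nullary using (¬_)
  open import Relation.Nullary.Decidable using (_×-dec_; ¬?)

  module _ (M : ℤ) {p N : ℕ} (p-prime : Prime p) .{{_ : NonZero N}} where

    private
      instance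
        p≢0 : NonZero p
        p≢0 = prime⇒nonZero p-prime
        pN≢0 : NonZero (p ℕ.* N)
        pN≢0 = ℕₚ.m*n≢0 p N

      lift : ℕ → ℕ → ℤ
      lift i r = + (i ℕ.* N ℕ.+ r)

      admissible-lift⁻ : ∀ i j l r s t → Admissible M N (lift i r) (lift j s) (lift l t) → Admissible M N (+ r) (+ s) (+ t)
      admissible-lift⁻ i j l r s t = admissible-periodic (+-multiple≡-mod i r) (+-multiple≡-mod j s) (+-multiple≡-mod l t)

      admissible-lift⁺ : ∀ i j l r s t → Admissible M N (+ r) (+ s) (+ t) → Admissible M N (lift i r) (lift j s) (lift l t)
      admissible-lift⁺ i j l r s t =
        admissible-periodic (≡-mod-sym (+-multiple≡-mod i r)) (≡-mod-sym (+-multiple≡-mod j s)) (≡-mod-sym (+-multiple≡-mod l t))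

    count-*-dividing : p ∣ N → count M (p ℕ.* N) ≡ p ℕ.* p ℕ.* p ℕ.* count M N
    count-*-dividing p∣N = begin
      count M (p ℕ.* N)
        ≡⟨ ∑³-blocks p N _ ⟩
      ∑³ N (λ r s t → ∑³ p (λ i j l → 𝟙 (admissible? M (p ℕ.* N) (lift i r) (lift j s) (lift l t))))
        ≡⟨ ∑³-cong N (λ r s t → trans (∑³-cong p (λ i j l → forget-lift i j l r s t)) (∑³-const p _)) ⟩
      ∑³ N (λ r s t → p ℕ.* p ℕ.* p ℕ.* 𝟙 (admissible? M N (+ r) (+ s) (+ t)))
        ≡⟨ ∑³-*ˡ N (p ℕ.* p ℕ.* p) _ ⟩
      p ℕ.* p ℕ.* p ℕ.* count M N ∎
      where
        open ≡-Reasoning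
        forget-lift : ∀ i j l r s t → 𝟙 (admissible? M (p ℕ.* N) (lift i r) (lift j s) (lift l t)) ≡ 𝟙 (admissible? M N (+ r) (+ s) (+ t))
        forget-lift i j l r s t = 𝟙-⇔ (admissible? _ _ _ _ _) (admissible? _ _ _ _ _)
          (λ adm → admissible-lift⁻ i j l r s t (proj₁ (admissible-*⁻ p-prime adm)))
          (λ adm → let adm′ = admissible-lift⁺ i j l r s t adm in admissible-*⁺ p-prime adm′ (admissible⇒ adm′ p-prime p∣N))

    open ResidueSums p-prime using (𝟙[≢0])
    open LocalCount p-prime M using (localCount; localCount-affine)

    count-*-coprime : ¬ p ∣ N → count M (p ℕ.* N) ≡ count M N ℕ.* localCount
    count-*-coprime p∤N = begin
      count M (p ℕ.* N)
        ≡⟨ ∑³-blocks p N _ ⟩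
      ∑³ N (λ r s t → ∑³ p (λ i j l → 𝟙 (admissible? M (p ℕ.* N) (lift i r) (lift j s) (lift l t))))
        ≡⟨ ∑³-cong N (λ r s t → trans (∑³-cong p (λ i j l → split-lift i j l r s t))
                                      (∑³-*ˡ p (𝟙 (admissible? M N (+ r) (+ s) (+ t))) (λ i j l → 𝟙[≢0] (Qᴹ M (lift i r) (lift j s) (lift l t))))) ⟩
      ∑³ N (λ r s t → 𝟙 (admissible? M N (+ r) (+ s) (+ t)) ℕ.* ∑³ p (λ i j l → 𝟙[≢0] (Qᴹ M (lift i r) (lift j s) (lift l t))))
        ≡⟨ ∑³-cong N (λ r s t → cong (𝟙 (admissible? M N (+ r) (+ s) (+ t)) ℕ.*_) (local-factor r s t)) ⟩
      ∑³ N (λ r s t → 𝟙 (admissible? M N (+ r) (+ s) (+ t)) ℕ.* localCount)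
        ≡⟨ ∑³-*ʳ N localCount _ ⟩
      count M N ℕ.* localCount ∎
      where
        open ≡-Reasoning
        split-lift : ∀ i j l r s t →
          𝟙 (admissible? M (p ℕ.* N) (lift i r) (lift j s) (lift l t))
            ≡ 𝟙 (admissible? M N (+ r) (+ s) (+ t)) ℕ.* 𝟙[≢0] (Qᴹ M (lift i r) (lift j s) (lift l t))
        split-lift i j l r s t = trans
          (𝟙-⇔ (admissible? _ _ _ _ _) (admissible? M N (+ r) (+ s) (+ t) ×-dec ¬? (Qᴹ M (lift i r) (lift j s) (lift l t) ≡? + 0 mod p))
               (λ adm → let adm′ , Q≢0 = admissible-*⁻ p-prime adm in admissible-lift⁻ i j l r s t adm′ , Q≢0)
               (λ (adm , Q≢0) → admissible-*⁺ p-prime (admissible-lift⁺ i j l r s t adm) Q≢0))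
          (𝟙-× (admissible? M N (+ r) (+ s) (+ t)) _)
        N≢0 : ¬ + N ≡ + 0 mod p
        N≢0 N≡0 = p∤N (≡0-mod⇒∣ N≡0)
        lift≡ : ∀ i r → lift i r ≡ + r + + N * + i
        lift≡ i r = trans (ℤₚ.pos-+ (i ℕ.* N) r) (trans (cong (_+ + r) (ℤₚ.pos-* i N)) (ℤ-identity (+ i) (+ N) (+ r)))
          where
            ℤ-identity : ∀ i N r → i * N + r ≡ r + N * i
            ℤ-identity = solve-∀
        lift-Qᴹ : ∀ r s t i j l → 𝟙[≢0] (Qᴹ M (lift i r) (lift j s) (lift l t)) ≡ 𝟙[≢0] (Qᴹ M (+ r + + N * + i) (+ s + + N * + j) (+ t + + N * + l))
        lift-Qᴹ r s t i j l = cong₃ {lift i r} {+ r + + N * + i} {lift j s} {+ s + + N * + j} {lift l t} {+ t + + N * + l}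
                                    (lift≡ i r) (lift≡ j s) (lift≡ l t)
          where
            cong₃ : ∀ {a a′ b b′ c c′} → a ≡ a′ → b ≡ b′ → c ≡ c′ → 𝟙[≢0] (Qᴹ M a b c) ≡ 𝟙[≢0] (Qᴹ M a′ b′ c′)
            cong₃ refl refl refl = refl
        local-factor : ∀ r s t → ∑³ p (λ i j l → 𝟙[≢0] (Qᴹ M (lift i r) (lift j s) (lift l t))) ≡ localCount
        local-factor r s t = trans (∑³-cong p (lift-Qᴹ r s t)) (localCount-affine N≢0 (+ r) (+ s) (+ t))

open Multiplicativity

module FourfoldCount where

  open import Data.Nat as ℕ using (ℕ; zero; suc; NonZero; _≟_)
  open import Data.Nat.DivMod using (_%_)
  open import Data.Nat.Divisibility using (_∣_; ∣-trans; ∣1⇒≡1; ∣m⇒∣m*n; ∣n⇒∣m*n; m∣m*n)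
  open import Data.Nat.GCD using (gcd; gcd-greatest; gcd[m,n]∣m; gcd[m,n]∣n; gcd[m,n]≢0)
  open import Data.Nat.Primality using (Prime; euclidsLemma; ¬prime[1])
  open import Data.Nat.Primality.Factorisation using (factorise; PrimeFactorisation)
  open import Data.Nat.ListAction using (product)
  open import Data.Integer using (ℤ; +_; _+_; _*_; _-_)
  import Data.Integer.Properties as ℤₚ
  open import Data.Integer.Tactic.RingSolver using (solve-∀)
  open import Data.Fin using (Fin; toℕ)
  import Data.Fin as Fin
  open import Data.List using (List; []; _∷_; _++_; map; filter; length; concatMap; tabulate; allFin)
  import Data.List.Properties as Listₚ
  open import Data.Nat.ListAction using (sum)
  open import Data.Nat.ListAction.Properties using (sum-++)
  open import Data.List.Relation.Unary.All using (All; []; _∷_)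
  open import Data.Product using (∃; _×_; _,_; proj₁; proj₂)
  open import Data.Sum using (inj₂; [_,_]′)
  open import Data.Empty using (⊥-elim)
  open import Relation.Binary.PropositionalEquality
  open import Relation.Nullary using (Dec; yes; no; ¬_)
  open import Relation.Nullary.Decidable using (_×-dec_)
  import Defs
  open import Defs using (allQuads; cond?; g4)

  prime-factor : ∀ g .{{_ : NonZero g}} → g ≢ 1 → ∃ λ q → Prime q × q ∣ g
  prime-factor g g≢1 = from-factors factors isFactorisation factorsPrime
    where
      open PrimeFactorisation (factorise g)
      from-factors : ∀ qs → g ≡ product qs → All Prime qs → ∃ λ q → Prime q × q ∣ g
      from-factors []       g≡1 _            = ⊥-elim (g≢1 g≡1)
      from-factors (q ∷ qs) g≡  (q-prime ∷ _) = q , q-prime , subst (q ∣_) (sym g≡) (m∣m*n (product qs))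

  gcd≡1⇒∤ : ∀ {A n q} → gcd A n ≡ 1 → Prime q → q ∣ n → ¬ q ∣ A
  gcd≡1⇒∤ gcd≡1 q-prime q∣n q∣A = ¬prime[1] (subst Prime (∣1⇒≡1 (subst (_ ∣_) gcd≡1 (gcd-greatest q∣A q∣n))) q-prime)

  ∤⇒gcd≡1 : ∀ A n .{{_ : NonZero n}} → (∀ {q} → Prime q → q ∣ n → ¬ q ∣ A) → gcd A n ≡ 1
  ∤⇒gcd≡1 A n no-common with gcd A n ≟ 1
  ... | yes gcd≡1 = gcd≡1
  ... | no  gcd≢1 = ⊥-elim (no-common q-prime (∣-trans q∣gcd (gcd[m,n]∣n A n)) (∣-trans q∣gcd (gcd[m,n]∣m A n)))
    where
      instance
        gcd≢0 : NonZero (gcd A n)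
        gcd≢0 = ℕ.≢-nonZero (gcd[m,n]≢0 A n (inj₂ (ℕ.≢-nonZero⁻¹ n)))
      q-prime = proj₁ (proj₂ (prime-factor (gcd A n) gcd≢1))
      q∣gcd = proj₂ (proj₂ (prime-factor (gcd A n) gcd≢1))

  module _ {A : Set} where

    length-filter : ∀ {P : A → Set} (P? : ∀ x → Dec (P x)) xs → length (filter P? xs) ≡ sum (map (λ x → 𝟙 (P? x)) xs)
    length-filter P? []       = refl
    length-filter P? (x ∷ xs) with P? x
    ... | yes _ = cong suc (length-filter P? xs)
    ... | no  _ = length-filter P? xs

    sum-map-concatMap : ∀ {B : Set} (f : B → ℕ) (g : A → List B) xs →
                        sum (map f (concatMap g xs)) ≡ sum (map (λ x → sum (map f (g x))) xs)
    sum-map-concatMap f g []       = refl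
    sum-map-concatMap f g (x ∷ xs) = begin
      sum (map f (g x ++ concatMap g xs))                 ≡⟨ cong sum (Listₚ.map-++ f (g x) (concatMap g xs)) ⟩
      sum (map f (g x) ++ map f (concatMap g xs))         ≡⟨ sum-++ (map f (g x)) _ ⟩
      sum (map f (g x)) ℕ.+ sum (map f (concatMap g xs))  ≡⟨ cong (sum (map f (g x)) ℕ.+_) (sum-map-concatMap f g xs) ⟩
      sum (map f (g x)) ℕ.+ sum (map (λ x → sum (map f (g x))) xs) ∎
      where open ≡-Reasoning

  sum-map-tabulate : ∀ n {A : Set} (g : Fin n → A) (f : A → ℕ) (h : ℕ → ℕ) → (∀ i → f (g i) ≡ h (toℕ i)) →
                     sum (map f (tabulate g)) ≡ ∑ n h
  sum-map-tabulate zero    g f h eq = refl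
  sum-map-tabulate (suc n) g f h eq =
    cong₂ ℕ._+_ (eq Fin.zero) (sum-map-tabulate n (λ i → g (Fin.suc i)) f (λ i → h (suc i)) (λ i → eq (Fin.suc i)))

  sum-map-allFin : ∀ n (f : Fin n → ℕ) (h : ℕ → ℕ) → (∀ i → f i ≡ h (toℕ i)) → sum (map f (allFin n)) ≡ ∑ n h
  sum-map-allFin n = sum-map-tabulate n (λ i → i)

  sum-map-concatMap-allFin : ∀ n {B : Set} (f : B → ℕ) (g : Fin n → List B) (h : ℕ → ℕ) → (∀ i → sum (map f (g i)) ≡ h (toℕ i)) →
                             sum (map f (concatMap g (allFin n))) ≡ ∑ n h
  sum-map-concatMap-allFin n f g h eq = trans (sum-map-concatMap f g (allFin n)) (sum-map-allFin n _ h eq)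

  module _ (m n : ℕ) .{{_ : NonZero n}} where

    private
      e₄ e₃ : ℕ → ℕ → ℕ → ℕ → ℕ
      e₄ a b c d = a ℕ.* b ℕ.* c ℕ.* d
      e₃ a b c d = a ℕ.* b ℕ.* c ℕ.+ a ℕ.* b ℕ.* d ℕ.+ a ℕ.* c ℕ.* d ℕ.+ b ℕ.* c ℕ.* d

      cond : ∀ a b c d → Dec (((a ℕ.+ b ℕ.+ c ℕ.+ d) % n ≡ m % n) × (gcd (e₄ a b c d) n ≡ 1) × (gcd (e₃ a b c d) n ≡ 1))
      cond a b c d = ((a ℕ.+ b ℕ.+ c ℕ.+ d) % n ≟ m % n) ×-dec (gcd (e₄ a b c d) n ≟ 1) ×-dec (gcd (e₃ a b c d) n ≟ 1)

      Q-pos : ∀ a b c d → Q (+ a) (+ b) (+ c) (+ d) ≡ + (e₄ a b c d ℕ.* e₃ a b c d)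
      Q-pos a b c d = sym (trans (ℤₚ.pos-* (e₄ a b c d) (e₃ a b c d)) (cong₂ _*_ (pos-e₄) (pos-e₃)))
        where
          pos-*₃ : ∀ x y z → + (x ℕ.* y ℕ.* z) ≡ + x * + y * + z
          pos-*₃ x y z = trans (ℤₚ.pos-* (x ℕ.* y) z) (cong (_* + z) (ℤₚ.pos-* x y))
          pos-e₄ : + e₄ a b c d ≡ + a * + b * + c * + d
          pos-e₄ = trans (ℤₚ.pos-* (a ℕ.* b ℕ.* c) d) (cong (_* + d) (pos-*₃ a b c))
          pos-e₃ : + e₃ a b c d ≡ + a * + b * + c + + a * + b * + d + + a * + c * + d + + b * + c * + d
          pos-e₃ = trans (ℤₚ.pos-+ _ (b ℕ.* c ℕ.* d)) (cong₂ _+_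
                     (trans (ℤₚ.pos-+ _ (a ℕ.* c ℕ.* d))
                            (cong₂ _+_ (trans (ℤₚ.pos-+ (a ℕ.* b ℕ.* c) _) (cong₂ _+_ (pos-*₃ a b c) (pos-*₃ a b d))) (pos-*₃ a c d)))
                     (pos-*₃ b c d))

    module _ (a b c : ℕ) where

      private
        t : ℤ
        t = (+ m) - + a - + b - + c

        pos-sum : ∀ d → + (a ℕ.+ b ℕ.+ c ℕ.+ d) ≡ + a + + b + + c + + d
        pos-sum d = trans (ℤₚ.pos-+ (a ℕ.+ b ℕ.+ c) d) (cong (_+ + d) (trans (ℤₚ.pos-+ (a ℕ.+ b) c) (cong (_+ + c) (ℤₚ.pos-+ a b))))

        sum≡m⇒d≡t : ∀ d → (a ℕ.+ b ℕ.+ c ℕ.+ d) % n ≡ m % n → + d ≡ t mod n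
        sum≡m⇒d≡t d eq = ≡-mod-trans (≡⇒≡-mod (ℤ-identity (+ a) (+ b) (+ c) (+ d)))
                                     (lhs≡rhs (⟦ sum≡ ⟧ ⊝ same (+ a) ⊝ same (+ b) ⊝ same (+ c)))
          where
            ℤ-identity : ∀ a b c d → d ≡ a + b + c + d - a - b - c
            ℤ-identity = solve-∀
            sum≡ : + a + + b + + c + + d ≡ (+ m) mod n
            sum≡ = subst (λ s → s ≡ (+ m) mod n) (pos-sum d)
                     (%-≡⇒≡-mod (a ℕ.+ b ℕ.+ c ℕ.+ d) m eq)

        d≡t⇒sum≡m : ∀ d → + d ≡ t mod n → (a ℕ.+ b ℕ.+ c ℕ.+ d) % n ≡ m % n
        d≡t⇒sum≡m d d≡t = ≡-mod⇒%-≡ (a ℕ.+ b ℕ.+ c ℕ.+ d) m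
          (subst (λ s → s ≡ (+ m) mod n) (sym (pos-sum d))
             (≡-mod-trans (lhs≡rhs (same (+ a) ⊕ same (+ b) ⊕ same (+ c) ⊕ ⟦ d≡t ⟧)) (≡⇒≡-mod (ℤ-identity (+ m) (+ a) (+ b) (+ c)))))
          where
            ℤ-identity : ∀ M a b c → a + b + c + (M - a - b - c) ≡ M
            ℤ-identity = solve-∀

        Qᴹ≡ : ∀ d {q} → + d ≡ t mod n → q ∣ n → Qᴹ (+ m) (+ a) (+ b) (+ c) ≡ + (e₄ a b c d ℕ.* e₃ a b c d) mod q
        Qᴹ≡ d d≡t q∣n =
          ≡-mod-trans (Q-cong-mod (≡-mod-refl {x = + a}) (≡-mod-refl {x = + b}) (≡-mod-refl {x = + c}) (≡-mod-∣ q∣n (≡-mod-sym d≡t)))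
                                    (≡⇒≡-mod (Q-pos a b c d))

        gcds⇒admissible : ∀ d → + d ≡ t mod n → gcd (e₄ a b c d) n ≡ 1 → gcd (e₃ a b c d) n ≡ 1 → Admissible (+ m) n (+ a) (+ b) (+ c)
        gcds⇒admissible d d≡t gcd₄≡1 gcd₃≡1 = admissible⇐ λ q-prime q∣n Q≡0 →
          let q∣e₄e₃ = ≡0-mod⇒∣ (≡-mod-trans (≡-mod-sym (Qᴹ≡ d d≡t q∣n)) Q≡0) in
          [ gcd≡1⇒∤ gcd₄≡1 q-prime q∣n , gcd≡1⇒∤ gcd₃≡1 q-prime q∣n ]′ (euclidsLemma (e₄ a b c d) (e₃ a b c d) q-prime q∣e₄e₃)

        admissible⇒gcds : ∀ d → + d ≡ t mod n → Admissible (+ m) n (+ a) (+ b) (+ c) → gcd (e₄ a b c d) n ≡ 1 × gcd (e₃ a b c d) n ≡ 1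
        admissible⇒gcds d d≡t adm =
            ∤⇒gcd≡1 (e₄ a b c d) n (λ q-prime q∣n q∣e₄ → Q≢0 q-prime q∣n (∣m⇒∣m*n (e₃ a b c d) q∣e₄))
          , ∤⇒gcd≡1 (e₃ a b c d) n (λ q-prime q∣n q∣e₃ → Q≢0 q-prime q∣n (∣n⇒∣m*n (e₄ a b c d) q∣e₃))
          where
            Q≢0 : ∀ {q} → Prime q → q ∣ n → ¬ q ∣ e₄ a b c d ℕ.* e₃ a b c d
            Q≢0 q-prime q∣n q∣e₄e₃ = admissible⇒ adm q-prime q∣n (≡-mod-trans (Qᴹ≡ d d≡t q∣n) (∣⇒≡0-mod q∣e₄e₃))

      ∑-cond≡𝟙-admissible : ∑[ d < n ] 𝟙 (cond a b c d) ≡ 𝟙 (admissible? (+ m) n (+ a) (+ b) (+ c))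
      ∑-cond≡𝟙-admissible =
        ∑-𝟙-unique n (residue t) (cond a b c) (admissible? (+ m) n (+ a) (+ b) (+ c)) (residue<p t)
          (λ d d<n (sum≡ , gcd₄≡1 , gcd₃≡1) → let d≡t = sum≡m⇒d≡t d sum≡ in
            <-≡-mod⇒≡ d<n (residue<p t) (≡-mod-trans d≡t (≡-mod-residue t)) , gcds⇒admissible d d≡t gcd₄≡1 gcd₃≡1)
          (λ adm → d≡t⇒sum≡m (residue t) d₀≡t , admissible⇒gcds (residue t) d₀≡t adm)
        where
          d₀≡t : + residue t ≡ t mod n
          d₀≡t = ≡-mod-sym (≡-mod-residue t)

    g4≡count : g4 m n ≡ count (+ m) n
    g4≡count = begin
      g4 m n
        ≡⟨ length-filter (cond? m n) (allQuads n) ⟩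
      sum (map (λ q → 𝟙 (cond? m n q)) (allQuads n))
        ≡⟨ sum-map-concatMap-allFin n F _ (λ a → ∑[ b < n ] ∑[ c < n ] ∑[ d < n ] 𝟙 (cond a b c d)) (λ a →
             sum-map-concatMap-allFin n F _ (λ b → ∑[ c < n ] ∑[ d < n ] 𝟙 (cond (toℕ a) b c d)) (λ b →
               sum-map-concatMap-allFin n F _ (λ c → ∑[ d < n ] 𝟙 (cond (toℕ a) (toℕ b) c d)) (λ c →
                 trans (cong sum (sym (Listₚ.map-∘ (allFin n)))) (sum-map-allFin n _ (cond-𝟙 (toℕ a) (toℕ b) (toℕ c)) (λ _ → refl))))) ⟩
      ∑[ a < n ] ∑[ b < n ] ∑[ c < n ] ∑[ d < n ] 𝟙 (cond a b c d)
        ≡⟨ ∑³-cong n ∑-cond≡𝟙-admissible ⟩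
      count (+ m) n ∎
      where
        open ≡-Reasoning
        F : Defs.Quad n → ℕ
        F q = 𝟙 (cond? m n q)
        cond-𝟙 : ℕ → ℕ → ℕ → ℕ → ℕ
        cond-𝟙 a b c d = 𝟙 (cond a b c d)

open FourfoldCount

module EulerProduct where

  open import Data.Nat as ℕ using (ℕ; zero; suc; NonZero; _<_; z≤n; s≤s; _∸_)
  import Data.Nat.Properties as ℕₚ
  open import Data.Nat.Divisibility using (_∣_; _∣?_; ∣⇒≤; ∣n⇒∣m*n; m∣m*n)
  open import Data.Nat.Primality using (Prime; prime?; prime⇒nonZero; euclidsLemma)
  open import Data.Rational using (ℚ; 1ℚ) renaming (_*_ to _*ℚ_)
  import Data.Rational.Properties as ℚₚ
  open import Data.List using (map; filter; foldr; applyUpTo)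
  open import Data.Product using (_×_; _,_)
  open import Data.Sum using (inj₁; inj₂)
  open import Data.Empty using (⊥-elim)
  open import Relation.Binary.PropositionalEquality
  open import Relation.Nullary using (Dec; yes; no; ¬_)
  open import Relation.Nullary.Decidable using (_×-dec_)
  open import Defs using (primeDivisors; localFactor)

  ∏ : ℕ → (ℕ → ℚ) → ℚ
  ∏ zero    f = 1ℚ
  ∏ (suc n) f = f 0 *ℚ ∏ n (λ i → f (suc i))

  syntax ∏ n (λ i → e) = ∏[ i < n ] e

  ∏-cong-< : ∀ n {f g : ℕ → ℚ} → (∀ i → i < n → f i ≡ g i) → ∏ n f ≡ ∏ n g
  ∏-cong-< zero    eq = refl
  ∏-cong-< (suc n) eq = cong₂ _*ℚ_ (eq 0 (s≤s z≤n)) (∏-cong-< n (λ i i<n → eq (suc i) (s≤s i<n)))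

  ∏-1 : ∀ n {f : ℕ → ℚ} → (∀ i → f i ≡ 1ℚ) → ∏ n f ≡ 1ℚ
  ∏-1 zero    eq = refl
  ∏-1 (suc n) eq = trans (cong₂ _*ℚ_ (eq 0) (∏-1 n (λ i → eq (suc i)))) (ℚₚ.*-identityˡ 1ℚ)

  ∏-split : ∀ m n (f : ℕ → ℚ) → ∏ (m ℕ.+ n) f ≡ ∏ m f *ℚ ∏[ i < n ] f (m ℕ.+ i)
  ∏-split zero    n f = sym (ℚₚ.*-identityˡ _)
  ∏-split (suc m) n f = trans (cong (f 0 *ℚ_) (∏-split m n (λ i → f (suc i)))) (sym (ℚₚ.*-assoc (f 0) _ _))

  ∏-pick : ∀ n j {f g : ℕ → ℚ} v → j < n → (∀ i → i < n → i ≢ j → f i ≡ g i) → f j ≡ v *ℚ g j → ∏ n f ≡ v *ℚ ∏ n g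
  ∏-pick (suc n) zero {f} {g} v _ elsewhere at-j =
    trans (cong₂ _*ℚ_ at-j (∏-cong-< n (λ i i<n → elsewhere (suc i) (s≤s i<n) (λ ())))) (ℚₚ.*-assoc v (g 0) _)
  ∏-pick (suc n) (suc j) {f} {g} v (s≤s j<n) elsewhere at-j = begin
    f 0 *ℚ ∏[ i < n ] f (suc i)          ≡⟨ cong₂ _*ℚ_ (elsewhere 0 (s≤s z≤n) (λ ()))
                                                       (∏-pick n j v j<n (λ i i<n i≢j → elsewhere (suc i) (s≤s i<n) (λ { refl → i≢j refl })) at-j) ⟩
    g 0 *ℚ (v *ℚ ∏[ i < n ] g (suc i))   ≡⟨ sym (ℚₚ.*-assoc (g 0) v _) ⟩
    g 0 *ℚ v *ℚ ∏[ i < n ] g (suc i)     ≡⟨ cong (_*ℚ ∏[ i < n ] g (suc i)) (ℚₚ.*-comm (g 0) v) ⟩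
    v *ℚ g 0 *ℚ ∏[ i < n ] g (suc i)     ≡⟨ ℚₚ.*-assoc v (g 0) _ ⟩
    v *ℚ (g 0 *ℚ ∏[ i < n ] g (suc i))   ∎
    where open ≡-Reasoning

  _^[_] : ∀ {A : Set} → ℚ → Dec A → ℚ
  v ^[ yes _ ] = v
  v ^[ no _ ]  = 1ℚ

  ^[]-⇔ : ∀ {A B : Set} v (A? : Dec A) (B? : Dec B) → (A → B) → (B → A) → v ^[ A? ] ≡ v ^[ B? ]
  ^[]-⇔ v (yes _) (yes _) _   _   = refl
  ^[]-⇔ v (yes a) (no ¬b) A→B _   = ⊥-elim (¬b (A→B a))
  ^[]-⇔ v (no ¬a) (yes b) _   B→A = ⊥-elim (¬a (B→A b))
  ^[]-⇔ v (no _)  (no _)  _   _   = refl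

  foldr-map-filter-applyUpTo : ∀ {P : ℕ → Set} (P? : ∀ x → Dec (P x)) (g : ℕ → ℚ) n (f : ℕ → ℕ) →
    foldr _*ℚ_ 1ℚ (map g (filter P? (applyUpTo f n))) ≡ ∏[ i < n ] (g (f i) ^[ P? (f i) ])
  foldr-map-filter-applyUpTo P? g zero    f = refl
  foldr-map-filter-applyUpTo P? g (suc n) f with P? (f 0)
  ... | yes _ = cong (g (f 0) *ℚ_) (foldr-map-filter-applyUpTo P? g n (λ i → f (suc i)))
  ... | no  _ = trans (foldr-map-filter-applyUpTo P? g n (λ i → f (suc i))) (sym (ℚₚ.*-identityˡ _))

  primeDivisor? : ∀ n x → Dec (Prime x × x ∣ n)
  primeDivisor? n x = prime? x ×-dec (x ∣? n)

  eulerProduct : ℕ → ℚ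
  eulerProduct n = foldr _*ℚ_ 1ℚ (map localFactor (primeDivisors n))

  eulerProduct-extend : ∀ n .{{_ : NonZero n}} K → n < K → ∏[ x < K ] (localFactor x ^[ primeDivisor? n x ]) ≡ eulerProduct n
  eulerProduct-extend n K n<K = begin
    ∏[ x < K ] (localFactor x ^[ primeDivisor? n x ])
      ≡⟨ cong (λ L → ∏[ x < L ] (localFactor x ^[ primeDivisor? n x ])) (sym (ℕₚ.m+[n∸m]≡n n<K)) ⟩
    ∏[ x < suc n ℕ.+ (K ∸ suc n) ] (localFactor x ^[ primeDivisor? n x ])
      ≡⟨ ∏-split (suc n) (K ∸ suc n) (λ x → localFactor x ^[ primeDivisor? n x ]) ⟩
    ∏[ x < suc n ] (localFactor x ^[ primeDivisor? n x ]) *ℚ ∏[ i < K ∸ suc n ] (localFactor (suc n ℕ.+ i) ^[ primeDivisor? n (suc n ℕ.+ i) ])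
      ≡⟨ cong (∏[ x < suc n ] (localFactor x ^[ primeDivisor? n x ]) *ℚ_) (∏-1 (K ∸ suc n) beyond-n) ⟩
    ∏[ x < suc n ] (localFactor x ^[ primeDivisor? n x ]) *ℚ 1ℚ
      ≡⟨ ℚₚ.*-identityʳ _ ⟩
    ∏[ x < suc n ] (localFactor x ^[ primeDivisor? n x ])
      ≡⟨ sym (foldr-map-filter-applyUpTo (primeDivisor? n) localFactor (suc n) (λ i → i)) ⟩
    eulerProduct n ∎
    where
      open ≡-Reasoning
      beyond-n : ∀ i → localFactor (suc n ℕ.+ i) ^[ primeDivisor? n (suc n ℕ.+ i) ] ≡ 1ℚ
      beyond-n i with primeDivisor? n (suc n ℕ.+ i)
      ... | yes (_ , x∣n) = ⊥-elim (ℕₚ.<⇒≱ (s≤s (ℕₚ.m≤m+n n i)) (∣⇒≤ x∣n))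
      ... | no  _         = refl

  module _ {p N : ℕ} (p-prime : Prime p) .{{_ : NonZero N}} where

    private
      instance
        p≢0 : NonZero p
        p≢0 = prime⇒nonZero p-prime
        pN≢0 : NonZero (p ℕ.* N)
        pN≢0 = ℕₚ.m*n≢0 p N

      N<1+pN : N < suc (p ℕ.* N)
      N<1+pN = s≤s (ℕₚ.m≤n*m N p)

      eulerProduct-* : eulerProduct (p ℕ.* N) ≡ ∏[ x < suc (p ℕ.* N) ] (localFactor x ^[ primeDivisor? (p ℕ.* N) x ])
      eulerProduct-* = sym (eulerProduct-extend (p ℕ.* N) (suc (p ℕ.* N)) ℕₚ.≤-refl)

      divisor-of-N : ∀ {x} → Prime x × x ∣ N → Prime x × x ∣ p ℕ.* N
      divisor-of-N (x-prime , x∣N) = x-prime , ∣n⇒∣m*n p x∣N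

    eulerProduct-*-dividing : p ∣ N → eulerProduct (p ℕ.* N) ≡ eulerProduct N
    eulerProduct-*-dividing p∣N = trans eulerProduct-*
      (trans (∏-cong-< (suc (p ℕ.* N)) (λ x _ → ^[]-⇔ (localFactor x) (primeDivisor? (p ℕ.* N) x) (primeDivisor? N x)
                                                        divisor-of-pN divisor-of-N))
             (eulerProduct-extend N (suc (p ℕ.* N)) N<1+pN))
      where
        divisor-of-pN : ∀ {x} → Prime x × x ∣ p ℕ.* N → Prime x × x ∣ N
        divisor-of-pN {x} (x-prime , x∣pN) with euclidsLemma p N x-prime x∣pN
        ... | inj₁ x∣p = x-prime , subst (_∣ N) (sym (prime∣prime⇒≡ p-prime x-prime x∣p)) p∣N
        ... | inj₂ x∣N = x-prime , x∣N

    eulerProduct-*-coprime : ¬ p ∣ N → eulerProduct (p ℕ.* N) ≡ localFactor p *ℚ eulerProduct N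
    eulerProduct-*-coprime p∤N = trans eulerProduct-*
      (trans (∏-pick (suc (p ℕ.* N)) p (localFactor p) (s≤s (ℕₚ.m≤m*n p N)) away-from-p at-p)
             (cong (localFactor p *ℚ_) (eulerProduct-extend N (suc (p ℕ.* N)) N<1+pN)))
      where
        away-from-p : ∀ x → x < suc (p ℕ.* N) → x ≢ p →
                      localFactor x ^[ primeDivisor? (p ℕ.* N) x ] ≡ localFactor x ^[ primeDivisor? N x ]
        away-from-p x _ x≢p = ^[]-⇔ (localFactor x) (primeDivisor? (p ℕ.* N) x) (primeDivisor? N x) divisor-of-pN divisor-of-N
          where
            divisor-of-pN : Prime x × x ∣ p ℕ.* N → Prime x × x ∣ N
            divisor-of-pN (x-prime , x∣pN) with euclidsLemma p N x-prime x∣pN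
            ... | inj₁ x∣p = ⊥-elim (x≢p (prime∣prime⇒≡ p-prime x-prime x∣p))
            ... | inj₂ x∣N = x-prime , x∣N
        at-p : localFactor p ^[ primeDivisor? (p ℕ.* N) p ] ≡ localFactor p *ℚ localFactor p ^[ primeDivisor? N p ]
        at-p with primeDivisor? (p ℕ.* N) p | primeDivisor? N p
        ... | yes _ | no _        = sym (ℚₚ.*-identityʳ (localFactor p))
        ... | yes _ | yes (_ , p∣N) = ⊥-elim (p∤N p∣N)
        ... | no ¬p∣pN | _        = ⊥-elim (¬p∣pN (p-prime , m∣m*n N))

open EulerProduct

module RationalFormula where

  open import Data.Nat as ℕ using (ℕ; suc; NonZero)
  open import Data.Nat.Divisibility using (_∣_)
  open import Data.Nat.Primality using (Prime)
  open import Data.Nat.Coprimality using (1-coprimeTo)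
  import Data.Nat.Coprimality as Coprime
  open import Data.Integer using (+_)
  import Data.Integer as ℤ
  import Data.Integer.Properties as ℤₚ
  open import Data.Integer.Tactic.RingSolver using (solve-∀)
  import Data.Nat.Tactic.RingSolver as ℕ-Solver
  open import Data.Rational using (ℚ; mkℚ; _/_; 1ℚ) renaming (_+_ to _+ℚ_; _-_ to _-ℚ_; _*_ to _*ℚ_)
  import Data.Rational.Properties as ℚₚ
  open import Data.Rational.Solver using (module +-*-Solver)
  open +-*-Solver
  open import Relation.Binary.PropositionalEquality
  open import Relation.Nullary using (¬_)
  open import Defs using (localFactor; formula)

  ι : ℕ → ℚ
  ι a = (+ a) / 1

  private
    ι≡mkℚ : ∀ a → ι a ≡ mkℚ (+ a) 0 (Coprime.sym (1-coprimeTo a))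
    ι≡mkℚ a = ℚₚ.normalize-coprime (Coprime.sym (1-coprimeTo a))

  ι-* : ∀ a b → ι (a ℕ.* b) ≡ ι a *ℚ ι b
  ι-* a b = trans (cong (_/ 1) (ℤₚ.pos-* a b)) (sym (cong₂ _*ℚ_ (ι≡mkℚ a) (ι≡mkℚ b)))

  ι-+ : ∀ a b → ι (a ℕ.+ b) ≡ ι a +ℚ ι b
  ι-+ a b = trans (cong (_/ 1) (ℤ-identity (+ a) (+ b))) (sym (cong₂ _+ℚ_ (ι≡mkℚ a) (ι≡mkℚ b)))
    where
      ℤ-identity : ∀ x y → x ℤ.+ y ≡ x ℤ.* + 1 ℤ.+ y ℤ.* + 1
      ℤ-identity = solve-∀

  1/n*n≡1 : ∀ n → ((+ 1) / suc n) *ℚ ι (suc n) ≡ 1ℚ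
  1/n*n≡1 n = trans (cong₂ _*ℚ_ (ℚₚ.normalize-coprime (1-coprimeTo (suc n))) (ι≡mkℚ (suc n)))
                    (ℚₚ.*-inverseˡ (mkℚ (+ suc n) 0 (Coprime.sym (1-coprimeTo (suc n)))))

  cube-localFactor : ∀ k → ι (k ℕ.* k ℕ.* k ℕ.+ 4 ℕ.* (k ℕ.* k) ℕ.+ 9 ℕ.* k ℕ.+ 5)
                           ≡ ι ((3 ℕ.+ k) ℕ.* (3 ℕ.+ k) ℕ.* (3 ℕ.+ k)) *ℚ localFactor (3 ℕ.+ k)
  cube-localFactor k = begin
    ι (k ℕ.* k ℕ.* k ℕ.+ 4 ℕ.* (k ℕ.* k) ℕ.+ 9 ℕ.* k ℕ.+ 5)
      ≡⟨ ι-cubic ⟩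
    K *ℚ K *ℚ K +ℚ ι 4 *ℚ (K *ℚ K) +ℚ ι 9 *ℚ K +ℚ ι 5
      ≡⟨ solve 1 (λ K → K :* K :* K :+ con (ι 4) :* (K :* K) :+ con (ι 9) :* K :+ con (ι 5)
                     := (con (ι 3) :+ K) :* (con (ι 3) :+ K) :* (con (ι 3) :+ K) :- con (ι 5) :* (con (ι 3) :+ K) :* (con (ι 3) :+ K)
                        :+ con (ι 12) :* (con (ι 3) :+ K) :- con (ι 13)) refl K ⟩
    (ι 3 +ℚ K) *ℚ (ι 3 +ℚ K) *ℚ (ι 3 +ℚ K) -ℚ ι 5 *ℚ (ι 3 +ℚ K) *ℚ (ι 3 +ℚ K) +ℚ ι 12 *ℚ (ι 3 +ℚ K) -ℚ ι 13
      ≡⟨ cong (λ P → P *ℚ P *ℚ P -ℚ ι 5 *ℚ P *ℚ P +ℚ ι 12 *ℚ P -ℚ ι 13) (sym (ι-+ 3 k)) ⟩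
    P *ℚ P *ℚ P -ℚ ι 5 *ℚ P *ℚ P +ℚ ι 12 *ℚ P -ℚ ι 13
      ≡⟨ solve 1 (λ P → P :* P :* P :- con (ι 5) :* P :* P :+ con (ι 12) :* P :- con (ι 13)
                     := P :* P :* P :- con (ι 5) :* P :* P :* con 1ℚ :+ con (ι 12) :* P :* con 1ℚ :* con 1ℚ
                        :- con (ι 13) :* con 1ℚ :* con 1ℚ :* con 1ℚ) refl P ⟩
    P *ℚ P *ℚ P -ℚ ι 5 *ℚ P *ℚ P *ℚ 1ℚ +ℚ ι 12 *ℚ P *ℚ 1ℚ *ℚ 1ℚ -ℚ ι 13 *ℚ 1ℚ *ℚ 1ℚ *ℚ 1ℚ
      ≡⟨ cong (λ u → P *ℚ P *ℚ P -ℚ ι 5 *ℚ P *ℚ P *ℚ u +ℚ ι 12 *ℚ P *ℚ u *ℚ u -ℚ ι 13 *ℚ u *ℚ u *ℚ u) (sym (1/n*n≡1 (2 ℕ.+ k))) ⟩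
    P *ℚ P *ℚ P -ℚ ι 5 *ℚ P *ℚ P *ℚ (x *ℚ P) +ℚ ι 12 *ℚ P *ℚ (x *ℚ P) *ℚ (x *ℚ P) -ℚ ι 13 *ℚ (x *ℚ P) *ℚ (x *ℚ P) *ℚ (x *ℚ P)
      ≡⟨ solve 2 (λ P x → P :* P :* P :- con (ι 5) :* P :* P :* (x :* P) :+ con (ι 12) :* P :* (x :* P) :* (x :* P)
                            :- con (ι 13) :* (x :* P) :* (x :* P) :* (x :* P)
                       := P :* P :* P :* (con 1ℚ :- con (ι 5) :* x :+ con (ι 12) :* x :* x :- con (ι 13) :* x :* x :* x)) refl P x ⟩
    P *ℚ P *ℚ P *ℚ localFactor (3 ℕ.+ k)
      ≡⟨ cong (_*ℚ localFactor (3 ℕ.+ k)) (sym (trans (ι-* ((3 ℕ.+ k) ℕ.* (3 ℕ.+ k)) (3 ℕ.+ k)) (cong (_*ℚ P) (ι-* (3 ℕ.+ k) (3 ℕ.+ k))))) ⟩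
    ι ((3 ℕ.+ k) ℕ.* (3 ℕ.+ k) ℕ.* (3 ℕ.+ k)) *ℚ localFactor (3 ℕ.+ k) ∎
    where
      open ≡-Reasoning
      K P x : ℚ
      K = ι k
      P = ι (3 ℕ.+ k)
      x = (+ 1) / (3 ℕ.+ k)
      ι-cubic : ι (k ℕ.* k ℕ.* k ℕ.+ 4 ℕ.* (k ℕ.* k) ℕ.+ 9 ℕ.* k ℕ.+ 5) ≡ K *ℚ K *ℚ K +ℚ ι 4 *ℚ (K *ℚ K) +ℚ ι 9 *ℚ K +ℚ ι 5
      ι-cubic = trans (ι-+ (k ℕ.* k ℕ.* k ℕ.+ 4 ℕ.* (k ℕ.* k) ℕ.+ 9 ℕ.* k) 5) (cong (_+ℚ ι 5) (trans (ι-+ (k ℕ.* k ℕ.* k ℕ.+ 4 ℕ.* (k ℕ.* k)) (9 ℕ.* k)) (cong₂ _+ℚ_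
                  (trans (ι-+ (k ℕ.* k ℕ.* k) (4 ℕ.* (k ℕ.* k))) (cong₂ _+ℚ_ (trans (ι-* (k ℕ.* k) k) (cong (_*ℚ K) (ι-* k k)))
                                                           (trans (ι-* 4 (k ℕ.* k)) (cong (ι 4 *ℚ_) (ι-* k k)))))
                  (ι-* 9 k))))

  module _ {p N : ℕ} (p-prime : Prime p) .{{_ : NonZero N}} where

    private
      ι-cube-* : ι ((p ℕ.* N) ℕ.* (p ℕ.* N) ℕ.* (p ℕ.* N)) ≡ ι (p ℕ.* p ℕ.* p) *ℚ ι (N ℕ.* N ℕ.* N)
      ι-cube-* = trans (cong ι (ℕ-identity p N)) (ι-* (p ℕ.* p ℕ.* p) (N ℕ.* N ℕ.* N))
        where
          ℕ-identity : ∀ p N → (p ℕ.* N) ℕ.* (p ℕ.* N) ℕ.* (p ℕ.* N) ≡ p ℕ.* p ℕ.* p ℕ.* (N ℕ.* N ℕ.* N)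
          ℕ-identity = ℕ-Solver.solve-∀

    formula-*-dividing : p ∣ N → formula (p ℕ.* N) ≡ ι (p ℕ.* p ℕ.* p) *ℚ formula N
    formula-*-dividing p∣N = begin
      ι ((p ℕ.* N) ℕ.* (p ℕ.* N) ℕ.* (p ℕ.* N)) *ℚ eulerProduct (p ℕ.* N)
        ≡⟨ cong₂ _*ℚ_ ι-cube-* (eulerProduct-*-dividing p-prime p∣N) ⟩
      ι (p ℕ.* p ℕ.* p) *ℚ ι (N ℕ.* N ℕ.* N) *ℚ eulerProduct N
        ≡⟨ ℚₚ.*-assoc (ι (p ℕ.* p ℕ.* p)) _ _ ⟩
      ι (p ℕ.* p ℕ.* p) *ℚ formula N ∎
      where open ≡-Reasoning

    formula-*-coprime : ¬ p ∣ N → formula (p ℕ.* N) ≡ formula N *ℚ (ι (p ℕ.* p ℕ.* p) *ℚ localFactor p)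
    formula-*-coprime p∤N = begin
      ι ((p ℕ.* N) ℕ.* (p ℕ.* N) ℕ.* (p ℕ.* N)) *ℚ eulerProduct (p ℕ.* N)
        ≡⟨ cong₂ _*ℚ_ ι-cube-* (eulerProduct-*-coprime p-prime p∤N) ⟩
      ι (p ℕ.* p ℕ.* p) *ℚ ι (N ℕ.* N ℕ.* N) *ℚ (localFactor p *ℚ eulerProduct N)
        ≡⟨ solve 4 (λ C D L E → C :* D :* (L :* E) := D :* E :* (C :* L)) refl
                   (ι (p ℕ.* p ℕ.* p)) (ι (N ℕ.* N ℕ.* N)) (localFactor p) (eulerProduct N) ⟩
      formula N *ℚ (ι (p ℕ.* p ℕ.* p) *ℚ localFactor p) ∎
      where open ≡-Reasoning

open RationalFormula

module OddAndEvenCases where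

  open import Data.Nat as ℕ using (ℕ; suc; NonZero; _<_; s≤s)
  import Data.Nat.Properties as ℕₚ
  open import Data.Nat.DivMod using (_%_; m%n<n)
  open import Data.Nat.Divisibility using (_∣_; _∣?_)
  open import Data.Nat.GCD using (gcd)
  open import Data.Nat.Primality using (Prime; prime[2]; ¬prime[0]; ¬prime[1]; productOfPrimes≢0)
  open import Data.Nat.Primality.Factorisation using (factorise; PrimeFactorisation)
  open import Data.Nat.ListAction using (product)
  open import Data.Nat.ListAction.Properties using (∈⇒∣product)
  open import Data.Integer using (+_)
  open import Data.Rational using () renaming (_*_ to _*ℚ_)
  open import Data.List using ([]; _∷_)
  open import Data.List.Membership.Propositional using (_∈_)
  open import Data.List.Relation.Unary.All as All using (All; []; _∷_)
  open import Data.Product using (∃; _×_; _,_)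
  open import Data.Empty using (⊥-elim)
  open import Relation.Binary.PropositionalEquality
  open import Relation.Nullary using (Dec; yes; no; ¬_)
  open import Relation.Nullary.Decidable using (from-yes)
  open import Defs
  open LocalCount using (localCount)

  odd-prime : ∀ {p} → Prime p → p ≢ 2 → ∃ λ k → p ≡ 3 ℕ.+ k
  odd-prime {0}             p-prime _   = ⊥-elim (¬prime[0] p-prime)
  odd-prime {1}             p-prime _   = ⊥-elim (¬prime[1] p-prime)
  odd-prime {2}             _       p≢2 = ⊥-elim (p≢2 refl)
  odd-prime {suc (suc (suc k))} _   _   = k , refl

  ι-localCount : ∀ {p} (p-prime : Prime p) → p ≢ 2 → ∀ M → ¬ M ≡ + 0 mod p →
                 ι (LocalCount.localCount p-prime M) ≡ ι (p ℕ.* p ℕ.* p) *ℚ localFactor p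
  ι-localCount {p} p-prime p≢2 M M≢0 = let k , p≡3+k = odd-prime p-prime p≢2 in
    trans (cong ι (trans (LocalCount.localCount≡affineCount p-prime M M≢0) (AffineCount.affineCount≡ p-prime k p≡3+k)))
          (subst (λ q → ι (k ℕ.* k ℕ.* k ℕ.+ 4 ℕ.* (k ℕ.* k) ℕ.+ 9 ℕ.* k ℕ.+ 5) ≡ ι (q ℕ.* q ℕ.* q) *ℚ localFactor q)
                 (sym p≡3+k) (cube-localFactor k))

  -- If a + b + c + d is odd then one of a, b, c, d is even, so abcd is even.
  Qᴹ≡0-mod-2 : ∀ {M} → M ≡ + 1 mod 2 → ∀ a b c → Qᴹ M a b c ≡ + 0 mod 2
  Qᴹ≡0-mod-2 M≡1 a b c = ≡-mod-trans (Qᴹ-cong-mod (≡-mod-residue a) (≡-mod-residue b) (≡-mod-residue c) M≡1)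
                                     (on-bits (residue a) (residue b) (residue c) (residue<p a) (residue<p b) (residue<p c))
    where
      on-bits : ∀ a b c → a < 2 → b < 2 → c < 2 → Qᴹ (+ 1) (+ a) (+ b) (+ c) ≡ + 0 mod 2
      on-bits 0 0 0 _ _ _ = from-yes (Qᴹ (+ 1) (+ 0) (+ 0) (+ 0) ≡? + 0 mod 2)
      on-bits 0 0 1 _ _ _ = from-yes (Qᴹ (+ 1) (+ 0) (+ 0) (+ 1) ≡? + 0 mod 2)
      on-bits 0 1 0 _ _ _ = from-yes (Qᴹ (+ 1) (+ 0) (+ 1) (+ 0) ≡? + 0 mod 2)
      on-bits 0 1 1 _ _ _ = from-yes (Qᴹ (+ 1) (+ 0) (+ 1) (+ 1) ≡? + 0 mod 2)
      on-bits 1 0 0 _ _ _ = from-yes (Qᴹ (+ 1) (+ 1) (+ 0) (+ 0) ≡? + 0 mod 2)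
      on-bits 1 0 1 _ _ _ = from-yes (Qᴹ (+ 1) (+ 1) (+ 0) (+ 1) ≡? + 0 mod 2)
      on-bits 1 1 0 _ _ _ = from-yes (Qᴹ (+ 1) (+ 1) (+ 1) (+ 0) ≡? + 0 mod 2)
      on-bits 1 1 1 _ _ _ = from-yes (Qᴹ (+ 1) (+ 1) (+ 1) (+ 1) ≡? + 0 mod 2)
      on-bits (suc (suc _)) _ _ (s≤s (s≤s ())) _ _
      on-bits _ (suc (suc _)) _ _ (s≤s (s≤s ())) _
      on-bits _ _ (suc (suc _)) _ _ (s≤s (s≤s ()))

  count≡0 : ∀ {M n} .{{_ : NonZero n}} → M ≡ + 1 mod 2 → 2 ∣ n → count M n ≡ 0
  count≡0 {M} {n} M≡1 2∣n =
    trans (∑³-cong n (λ a b c → 𝟙-no (admissible? M n (+ a) (+ b) (+ c))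
                                     (λ adm → admissible⇒ adm prime[2] 2∣n (Qᴹ≡0-mod-2 M≡1 (+ a) (+ b) (+ c)))))
          (trans (∑³-const n 0) (ℕₚ.*-zeroʳ (n ℕ.* n ℕ.* n)))

  odd⇒≡1-mod-2 : ∀ m → ¬ 2 ∣ m → + m ≡ + 1 mod 2
  odd⇒≡1-mod-2 m 2∤m = by-residue (m % 2) (≡-mod-% m) (m%n<n m 2)
    where
      by-residue : ∀ r → + m ≡ + r mod 2 → r < 2 → + m ≡ + 1 mod 2
      by-residue 0 m≡0 _ = ⊥-elim (2∤m (≡0-mod⇒∣ m≡0))
      by-residue 1 m≡1 _ = m≡1
      by-residue (suc (suc _)) _ (s≤s (s≤s ()))

  module _ (m : ℕ) where

    count-*-formula : ∀ {p N} → Prime p → .{{_ : NonZero N}} → p ≢ 2 → ¬ p ∣ m →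
                      ι (count (+ m) N) ≡ formula N → Dec (p ∣ N) → ι (count (+ m) (p ℕ.* N)) ≡ formula (p ℕ.* N)
    count-*-formula {p} {N} p-prime p≢2 p∤m ih (yes p∣N) = begin
      ι (count (+ m) (p ℕ.* N))                ≡⟨ cong ι (count-*-dividing (+ m) p-prime p∣N) ⟩
      ι (p ℕ.* p ℕ.* p ℕ.* count (+ m) N)      ≡⟨ ι-* (p ℕ.* p ℕ.* p) (count (+ m) N) ⟩
      ι (p ℕ.* p ℕ.* p) *ℚ ι (count (+ m) N)   ≡⟨ cong (ι (p ℕ.* p ℕ.* p) *ℚ_) ih ⟩
      ι (p ℕ.* p ℕ.* p) *ℚ formula N       ≡⟨ sym (formula-*-dividing p-prime p∣N) ⟩
      formula (p ℕ.* N)                    ∎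
      where open ≡-Reasoning
    count-*-formula {p} {N} p-prime p≢2 p∤m ih (no p∤N) = begin
      ι (count (+ m) (p ℕ.* N))                                ≡⟨ cong ι (count-*-coprime (+ m) p-prime p∤N) ⟩
      ι (count (+ m) N ℕ.* localCount p-prime (+ m))               ≡⟨ ι-* (count (+ m) N) (localCount p-prime (+ m)) ⟩
      ι (count (+ m) N) *ℚ ι (localCount p-prime (+ m))
        ≡⟨ cong₂ _*ℚ_ ih (ι-localCount p-prime p≢2 (+ m) (λ M≡0 → p∤m (≡0-mod⇒∣ M≡0))) ⟩
      formula N *ℚ (ι (p ℕ.* p ℕ.* p) *ℚ localFactor p)   ≡⟨ sym (formula-*-coprime p-prime p∤N) ⟩
      formula (p ℕ.* N)                                    ∎
      where open ≡-Reasoning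

    count-product-formula : ∀ ps → All Prime ps → All (λ p → p ≢ 2 × ¬ p ∣ m) ps → ι (count (+ m) (product ps)) ≡ formula (product ps)
    count-product-formula []       _                  _                = refl
    count-product-formula (p ∷ ps) (p-prime ∷ primes) ((p≢2 , p∤m) ∷ odd) =
      count-*-formula p-prime {{productOfPrimes≢0 primes}} p≢2 p∤m (count-product-formula ps primes odd) (p ∣? product ps)

    odd-case : ∀ n .{{_ : NonZero n}} → gcd m n ≡ 1 → ¬ 2 ∣ n → ι (g4 m n) ≡ formula n
    odd-case n gcd≡1 2∤n = trans (cong ι {g4 m n} (g4≡count m n)) (via-factors (factorise n))
      where
        via-factors : PrimeFactorisation n → ι (count (+ m) n) ≡ formula n
        via-factors record { factors = ps ; isFactorisation = n≡∏ps ; factorsPrime = primes } =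
          subst (λ t → ι (count (+ m) t) ≡ formula t) (sym n≡∏ps) (count-product-formula ps primes (All.tabulate odd-and-coprime))
          where
            odd-and-coprime : ∀ {p} → p ∈ ps → p ≢ 2 × ¬ p ∣ m
            odd-and-coprime {p} p∈ps = (λ { refl → 2∤n p∣n }) , gcd≡1⇒∤ gcd≡1 (All.lookup primes p∈ps) p∣n
              where
                p∣n : p ∣ n
                p∣n = subst (p ∣_) (sym n≡∏ps) (∈⇒∣product p∈ps)

    even-case : ∀ n .{{_ : NonZero n}} → gcd m n ≡ 1 → 2 ∣ n → g4 m n ≡ 0
    even-case n gcd≡1 2∣n = trans (g4≡count m n) (count≡0 (odd⇒≡1-mod-2 m (gcd≡1⇒∤ gcd≡1 prime[2] 2∣n)) 2∣n)

open OddAndEvenCases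

open import Defs
open import Data.Nat using (ℕ; NonZero; _≤_)
open import Data.Nat.GCD using (gcd)
open import Data.Nat.Divisibility using (_∣_)
open import Data.Product using (_×_; _,_)
open import Data.Integer using (+_)
open import Data.Rational using (_/_)
open import Relation.Binary.PropositionalEquality using (_≡_)
open import Relation.Nullary using (¬_)

mainTheorem15 : (m n : ℕ) → 1 ≤ m → .{{_ : NonZero n}} → gcd m n ≡ 1 →
    ((¬ (2 ∣ n)) → (+ (g4 m n)) / 1 ≡ formula n) × (2 ∣ n → g4 m n ≡ 0)
mainTheorem15 m n _ gcd≡1 = odd-case m n gcd≡1 , even-case m n gcd≡1
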